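{- Let $m,n>2$ be integers and $\Gamma={\rm SR}(m,n)$. If $n>3$, then ${\rm Aut}(\Gamma)$ consists exactly of the maps permuting the coordinate positions, so ${\rm Aut}(\Gamma)\cong{\rm Sym}(m)$. If $n=3$, then ${\rm Aut}(\Gamma)\cong{\rm Sym}(m).2$: it is generated by the coordinate permutations together with the map $\tau$ that interchanges the digits $1$ and $2$ in each vertex having a coordinate equal to $2$ (so $\tau(2e_i+e_j)=e_i+2e_j$) and fixes all other vertices.
   Context: Let $\mathbb{N}$ denote the nonnegative integers. For $m,n\in\mathbb{N}$, the simplicial rook graph ${\rm SR}(m,n)$ has as vertices the vectors in $\mathbb{N}^m$ with coordinate sum $n$, two vertices being adjacent when they differ in precisely two coordinate positions. The symmetric group ${\rm Sym}(m)$ acts on it by permuting coordinates. $e_i$ denotes the $i$-th standard unit vector. -}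

module Defs where

open import Data.Nat using (ℕ; zero; suc; _+_; _≡ᵇ_)
open import Data.Bool using (Bool; true; false; if_then_else_; _∨_)
open import Data.Vec using (Vec; []; _∷_; lookup; tabulate; map; sum)
open import Data.Fin using (Fin)
open import Data.Fin.Permutation using (Permutation′; _⟨$⟩ʳ_)
open import Data.Product using (Σ; proj₁; _,_)
open import Relation.Binary.PropositionalEquality using (_≡_)
open import Function.Definitions using (Bijective)
open import Function.Bundles using (_⇔_)

Vertex : ℕ → ℕ → Set
Vertex m n = Σ (Vec ℕ m) (λ v → sum v ≡ n)

diffCount : ∀ {m} → Vec ℕ m → Vec ℕ m → ℕ
diffCount [] [] = 0
diffCount (a ∷ as) (b ∷ bs) = (if a ≡ᵇ b then 0 else 1) + diffCount as bs

Adj : ∀ {m n} → Vertex m n → Vertex m n → Set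
Adj u v = diffCount (proj₁ u) (proj₁ v) ≡ 2

record IsAut {m n : ℕ} (f : Vertex m n → Vertex m n) : Set where
  field
    bijective : Bijective _≡_ _≡_ f
    preservesAdj : ∀ u v → Adj u v ⇔ Adj (f u) (f v)

permuteVec : ∀ {m} → Permutation′ m → Vec ℕ m → Vec ℕ m
permuteVec σ v = tabulate (λ i → lookup v (σ ⟨$⟩ʳ i))

swap12 : ℕ → ℕ
swap12 1 = 2
swap12 2 = 1
swap12 k = k

hasTwo : ∀ {m} → Vec ℕ m → Bool
hasTwo [] = false
hasTwo (a ∷ as) = (a ≡ᵇ 2) ∨ hasTwo as

tauVec : ∀ {m} → Vec ℕ m → Vec ℕ m
tauVec v = if hasTwo v then map swap12 v else v

Realizes : ∀ {m n} → (Vertex m n → Vertex m n) → (Vec ℕ m → Vec ℕ m) → Set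
Realizes f g = ∀ v → proj₁ (f v) ≡ g (proj₁ v)

AgreeOnVertices : ∀ {m} → ℕ → (Vec ℕ m → Vec ℕ m) → (Vec ℕ m → Vec ℕ m) → Set
AgreeOnVertices n g h = ∀ v → sum v ≡ n → g v ≡ h v

-- A corner n·eᵢ has no claw, since its neighbourhood is a rook's
--    graph, while every other vertex has one.  So automorphisms permute the
--    corners, and after composing with a coordinate permutation an automorphism
--    fixes every corner (normalise).
--  * Distances.  The distance from n·eᵢ to v is the number of nonzero
--    coordinates of v other than i; hence vᵢ ≠ 0 iff v is at least as close to
--    n·eᵢ as to every other corner, and corner-fixing automorphisms preserve
--    supports.
--  * n = 3.  Preserving supports, a corner-fixing automorphism fixes every
--    vertex without a coordinate 2 and fixes or swaps each 2·eᵢ + e_j;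
--    adjacency propagates this choice, so it is the identity or τ.
--  * n > 3.  The layer {v | vᵢ > 0} of SR(m,n) is a copy of SR(m,n-1) to which a
--    corner-fixing automorphism restricts; by induction the restriction is the
--    identity (τ is excluded on SR(m,4) by comparing two layers), so the
--    automorphism is the identity.

module Submission where

open import Defs
open import Data.Nat using (ℕ; zero; suc; _+_; _≤_; _<_; z≤n; s≤s; _≤?_; _≡ᵇ_; pred; ≢-nonZero)
open import Data.Nat.Properties
open import Data.Nat.Tactic.RingSolver using (solve-∀)
open import Data.Bool using (true; false; if_then_else_; T)
open import Data.Vec using (Vec; []; _∷_; lookup; tabulate; map; sum)
open import Data.Vec.Properties using (lookup∘tabulate; lookup-map)
open import Data.Vec.Relation.Binary.Pointwise.Extensional using (ext; Pointwise-≡⇒≡)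
open import Data.Vec.Functional using (updateAt)
open import Data.Vec.Functional.Properties using (updateAt-updates; updateAt-minimal)
open import Data.Fin using (Fin; zero; suc) renaming (_≟_ to _≟ᶠ_)
open import Data.Fin.Properties using (any?)
open import Data.Fin.Permutation using (Permutation′; _≈_; _⟨$⟩ʳ_; _⟨$⟩ˡ_; inverseˡ; inverseʳ; permutation; flip)
open import Data.Product using (Σ; ∃; _×_; _,_; proj₁; proj₂)
open import Data.Sum using (_⊎_; inj₁; inj₂; fromInj₁; fromInj₂)
open import Data.Empty using (⊥; ⊥-elim)
open import Function using (_∘_; const)
open import Function.Bundles using (mk⇔; Equivalence)
open import Relation.Binary.PropositionalEquality
open import Relation.Nullary using (¬_; Dec; yes; no)
open import Algebra.Properties.CommutativeMonoid.Sum +-0-commutativeMonoid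
  using (sum-permute) renaming (sum to ∑; sum-cong-≗ to ∑-cong)

fin-cases : ∀ {m} {P : Set} (i j : Fin m) → (i ≡ j → P) → (i ≢ j → P) → P
fin-cases i j eq ne with i ≟ᶠ j
... | yes e = eq e
... | no e = ne e

infixl 5 _[_]≔_
_[_]≔_ : ∀ {m} → (Fin m → ℕ) → Fin m → ℕ → Fin m → ℕ
h [ i ]≔ a = updateAt h i (const a)

≔-same : ∀ {m} (h : Fin m → ℕ) i a → (h [ i ]≔ a) i ≡ a
≔-same h i a = updateAt-updates i h

≔-other : ∀ {m} (h : Fin m → ℕ) {i j} a → j ≢ i → (h [ i ]≔ a) j ≡ h j
≔-other h {i} {j} a j≢i = updateAt-minimal j i h j≢i

≔-agree : ∀ {m} {h k : Fin m → ℕ} (i : Fin m) a r → (r ≢ i → h r ≡ k r) → (h [ i ]≔ a) r ≡ (k [ i ]≔ a) r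
≔-agree {h = h} {k} i a r agree = fin-cases r i
  (λ { refl → trans (≔-same h r a) (sym (≔-same k r a)) })
  (λ r≢i → trans (≔-other h a r≢i) (trans (agree r≢i) (sym (≔-other k a r≢i))))

∑-update : ∀ {m} (h : Fin m → ℕ) i a → ∑ (h [ i ]≔ a) + h i ≡ ∑ h + a
∑-update {suc m} h zero a = trans (+-assoc a _ (h zero)) (trans (+-comm a _) (cong (_+ a) (+-comm _ (h zero))))
∑-update {suc m} h (suc i) a = begin
  h zero + ∑ (t [ i ]≔ a) + t i   ≡⟨ +-assoc (h zero) _ (t i) ⟩
  h zero + (∑ (t [ i ]≔ a) + t i) ≡⟨ cong (h zero +_) (∑-update t i a) ⟩
  h zero + (∑ t + a)              ≡⟨ +-assoc (h zero) (∑ t) a ⟨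
  h zero + ∑ t + a                ∎
  where
  open ≡-Reasoning
  t = λ j → h (suc j)

∑-split : ∀ {m} (i : Fin m) (h : Fin m → ℕ) → ∑ h ≡ h i + ∑ (h [ i ]≔ 0)
∑-split i h = trans (sym (+-identityʳ (∑ h))) (trans (sym (∑-update h i 0)) (+-comm _ (h i)))

∑-split₂ : ∀ {m} {i j : Fin m} (h : Fin m → ℕ) → i ≢ j → ∑ h ≡ h i + h j + ∑ (h [ i ]≔ 0 [ j ]≔ 0)
∑-split₂ {i = i} {j} h i≢j = begin
  ∑ h                                      ≡⟨ ∑-split i h ⟩
  h i + ∑ (h [ i ]≔ 0)                     ≡⟨ cong (h i +_) (∑-split j (h [ i ]≔ 0)) ⟩
  h i + ((h [ i ]≔ 0) j + ∑ (h [ i ]≔ 0 [ j ]≔ 0)) ≡⟨ cong (λ x → h i + (x + ∑ (h [ i ]≔ 0 [ j ]≔ 0))) (≔-other h 0 (i≢j ∘ sym)) ⟩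
  h i + (h j + ∑ (h [ i ]≔ 0 [ j ]≔ 0))    ≡⟨ +-assoc (h i) (h j) _ ⟨
  h i + h j + ∑ (h [ i ]≔ 0 [ j ]≔ 0)      ∎
  where open ≡-Reasoning

coord≤∑ : ∀ {m} (h : Fin m → ℕ) i → h i ≤ ∑ h
coord≤∑ h i = subst (h i ≤_) (sym (∑-split i h)) (m≤m+n (h i) _)

coords≤∑ : ∀ {m} {i j : Fin m} (h : Fin m → ℕ) → i ≢ j → h i + h j ≤ ∑ h
coords≤∑ h i≢j = subst (_ ≤_) (sym (∑-split₂ h i≢j)) (m≤m+n _ _)

∑-zero : ∀ {m} {h : Fin m → ℕ} → (∀ i → h i ≡ 0) → ∑ h ≡ 0
∑-zero {zero} z = refl
∑-zero {suc m} z = cong₂ _+_ (z zero) (∑-zero (λ i → z (suc i)))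

∑≡0⇒coord≡0 : ∀ {m} (h : Fin m → ℕ) → ∑ h ≡ 0 → ∀ i → h i ≡ 0
∑≡0⇒coord≡0 h z i = n≤0⇒n≡0 (subst (h i ≤_) z (coord≤∑ h i))

∑-nonzero : ∀ {m} (h : Fin m → ℕ) → ∑ h ≢ 0 → ∃ λ i → h i ≢ 0
∑-nonzero {zero} h ne = ⊥-elim (ne refl)
∑-nonzero {suc m} h ne with h zero ≟ 0
... | no h₀≢0 = zero , h₀≢0
... | yes h₀≡0 with ∑-nonzero (λ i → h (suc i)) (λ e → ne (cong₂ _+_ h₀≡0 e))
... | i , hᵢ≢0 = suc i , hᵢ≢0

∑-point : ∀ {m} (i : Fin m) (h : Fin m → ℕ) → (∀ j → j ≢ i → h j ≡ 0) → ∑ h ≡ h i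
∑-point i h z = trans (∑-split i h) (trans (cong (h i +_) (∑-zero rest)) (+-identityʳ (h i)))
  where
  rest : ∀ j → (h [ i ]≔ 0) j ≡ 0
  rest j = fin-cases j i (λ { refl → ≔-same h j 0 }) (λ j≢i → trans (≔-other h 0 j≢i) (z j j≢i))

∑-two : ∀ {m} {i j : Fin m} (h : Fin m → ℕ) → i ≢ j → (∀ l → l ≢ i → l ≢ j → h l ≡ 0) → ∑ h ≡ h i + h j
∑-two {i = i} {j} h i≢j z = trans (∑-split₂ h i≢j) (trans (cong (h i + h j +_) (∑-zero rest)) (+-identityʳ _))
  where
  rest : ∀ l → (h [ i ]≔ 0 [ j ]≔ 0) l ≡ 0
  rest l = fin-cases l j (λ { refl → ≔-same _ l 0 }) λ l≢j → trans (≔-other _ 0 l≢j)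
             (fin-cases l i (λ { refl → ≔-same h l 0 }) λ l≢i → trans (≔-other h 0 l≢i) (z l l≢i l≢j))

∑-three : ∀ {m} {i j k : Fin m} (h : Fin m → ℕ) → i ≢ j → i ≢ k → j ≢ k →
          (∀ l → l ≢ i → l ≢ j → l ≢ k → h l ≡ 0) → ∑ h ≡ h i + h j + h k
∑-three {i = i} {j} {k} h i≢j i≢k j≢k z =
  trans (∑-split₂ h i≢j) (cong (h i + h j +_) (trans (∑-point k rest zeros) rest-k))
  where
  rest = h [ i ]≔ 0 [ j ]≔ 0
  rest-k : rest k ≡ h k
  rest-k = trans (≔-other _ 0 (j≢k ∘ sym)) (≔-other h 0 (i≢k ∘ sym))
  zeros : ∀ l → l ≢ k → rest l ≡ 0
  zeros l l≢k = fin-cases l j (λ { refl → ≔-same _ l 0 }) λ l≢j → trans (≔-other _ 0 l≢j)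
                  (fin-cases l i (λ { refl → ≔-same h l 0 }) λ l≢i → trans (≔-other h 0 l≢i) (z l l≢i l≢j l≢k))

module _ {m} {i j : Fin m} (h k : Fin m → ℕ) (i≢j : i ≢ j) (agree : ∀ r → r ≢ i → r ≢ j → h r ≡ k r) where
  private
    rests : ∑ (h [ i ]≔ 0 [ j ]≔ 0) ≡ ∑ (k [ i ]≔ 0 [ j ]≔ 0)
    rests = ∑-cong (λ r → ≔-agree j 0 r (λ r≢j → ≔-agree i 0 r (λ r≢i → agree r r≢i r≢j)))

  ∑-agree₂ : h i + h j ≡ k i + k j → ∑ h ≡ ∑ k
  ∑-agree₂ e = trans (∑-split₂ h i≢j) (trans (cong₂ _+_ e rests) (sym (∑-split₂ k i≢j)))

  ∑-agree₂-≤ : h i + h j ≤ suc (k i + k j) → ∑ h ≤ suc (∑ k)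
  ∑-agree₂-≤ le = subst₂ (λ x y → x ≤ suc y) (sym (∑-split₂ h i≢j)) (sym (∑-split₂ k i≢j))
                    (subst (λ r → h i + h j + r ≤ suc (k i + k j + _)) (sym rests) (+-monoˡ-≤ _ le))

  ∑-agree₂⁻ : ∑ h ≡ ∑ k → h i + h j ≡ k i + k j
  ∑-agree₂⁻ e = +-cancelʳ-≡ _ _ _ (trans (sym (∑-split₂ h i≢j)) (trans e (trans (∑-split₂ k i≢j) (cong (k i + k j +_) (sym rests)))))

∑-agree₃ : ∀ {m} {i j k : Fin m} (h h′ : Fin m → ℕ) → i ≢ j → i ≢ k → j ≢ k →
           (∀ r → r ≢ i → r ≢ j → r ≢ k → h r ≡ h′ r) → h i + h j + h k ≡ h′ i + h′ j + h′ k → ∑ h ≡ ∑ h′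
∑-agree₃ {i = i} {j} {k} h h′ i≢j i≢k j≢k agree e = begin
  ∑ h                                               ≡⟨ split h ⟩
  h i + h j + (h k + ∑ (zeroed h))                  ≡⟨ +-assoc (h i + h j) (h k) _ ⟨
  h i + h j + h k + ∑ (zeroed h)                    ≡⟨ cong₂ _+_ e (∑-cong rests) ⟩
  h′ i + h′ j + h′ k + ∑ (zeroed h′)                ≡⟨ +-assoc (h′ i + h′ j) (h′ k) _ ⟩
  h′ i + h′ j + (h′ k + ∑ (zeroed h′))              ≡⟨ split h′ ⟨
  ∑ h′                                              ∎
  where
  open ≡-Reasoning
  zeroed : (Fin _ → ℕ) → Fin _ → ℕ
  zeroed g = g [ i ]≔ 0 [ j ]≔ 0 [ k ]≔ 0
  split : ∀ g → ∑ g ≡ g i + g j + (g k + ∑ (zeroed g))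
  split g = trans (∑-split₂ g i≢j) (cong (g i + g j +_) (trans (∑-split k (g [ i ]≔ 0 [ j ]≔ 0))
              (cong (_+ ∑ (zeroed g)) (trans (≔-other _ 0 (j≢k ∘ sym)) (≔-other g 0 (i≢k ∘ sym))))))
  rests : ∀ r → zeroed h r ≡ zeroed h′ r
  rests r = ≔-agree k 0 r λ r≢k → ≔-agree j 0 r λ r≢j → ≔-agree i 0 r λ r≢i → agree r r≢i r≢j r≢k

∑-mono : ∀ {m} {h k : Fin m → ℕ} → (∀ i → h i ≤ k i) → ∑ h ≤ ∑ k
∑-mono {zero} le = z≤n
∑-mono {suc m} le = +-mono-≤ (le zero) (∑-mono (λ i → le (suc i)))

∑-≤-≡ : ∀ {m} (h k : Fin m → ℕ) → (∀ i → h i ≤ k i) → ∑ h ≡ ∑ k → ∀ i → h i ≡ k i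
∑-≤-≡ h k le e i with m≤n⇒m<n∨m≡n (le i)
... | inj₂ hᵢ≡kᵢ = hᵢ≡kᵢ
... | inj₁ hᵢ<kᵢ = ⊥-elim (<⇒≢ ∑h<∑k e)
  where
  rest : ∀ r → (h [ i ]≔ 0) r ≤ (k [ i ]≔ 0) r
  rest r = fin-cases r i
    (λ { refl → subst₂ _≤_ (sym (≔-same h r 0)) (sym (≔-same k r 0)) z≤n })
    (λ r≢i → subst₂ _≤_ (sym (≔-other h 0 r≢i)) (sym (≔-other k 0 r≢i)) (le r))
  ∑h<∑k : ∑ h < ∑ k
  ∑h<∑k = subst₂ _<_ (sym (∑-split i h)) (sym (∑-split i k)) (+-mono-<-≤ hᵢ<kᵢ (∑-mono rest))

∑-permute : ∀ {m} (σ : Permutation′ m) (h : Fin m → ℕ) → ∑ (λ p → h (σ ⟨$⟩ʳ p)) ≡ ∑ h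
∑-permute σ h = sym (sum-permute h σ)

sum≡∑ : ∀ {m} (v : Vec ℕ m) → sum v ≡ ∑ (lookup v)
sum≡∑ [] = refl
sum≡∑ (a ∷ v) = cong (a +_) (sum≡∑ v)

⟦_⟧ : ∀ {m n} → Vertex m n → Fin m → ℕ
⟦ v ⟧ i = lookup (proj₁ v) i

∑⟦_⟧ : ∀ {m n} (v : Vertex m n) → ∑ ⟦ v ⟧ ≡ n
∑⟦ v , sum≡n ⟧ = trans (sym (sum≡∑ v)) sum≡n

mkV : ∀ {m n} (h : Fin m → ℕ) → ∑ h ≡ n → Vertex m n
mkV h ∑h≡n = tabulate h , trans (sum≡∑ (tabulate h)) (trans (∑-cong (lookup∘tabulate h)) ∑h≡n)

mkV-at : ∀ {m n} (h : Fin m → ℕ) (∑h≡n : ∑ h ≡ n) i → ⟦ mkV h ∑h≡n ⟧ i ≡ h i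
mkV-at h _ i = lookup∘tabulate h i

vec-ext : ∀ {m} {u v : Vec ℕ m} → (∀ i → lookup u i ≡ lookup v i) → u ≡ v
vec-ext e = Pointwise-≡⇒≡ (ext e)

vertex-ext : ∀ {m n} {u v : Vertex m n} → (∀ i → ⟦ u ⟧ i ≡ ⟦ v ⟧ i) → u ≡ v
vertex-ext {u = a , p} {b , q} e with vec-ext {u = a} {b} e
... | refl = cong (a ,_) (≡-irrelevant p q)

δ : ℕ → ℕ → ℕ
δ a b = if a ≡ᵇ b then 0 else 1

δ-≡ : ∀ a → δ a a ≡ 0
δ-≡ a with a ≡ᵇ a in e
... | true = refl
... | false = ⊥-elim (subst T e (≡⇒≡ᵇ a a refl))

δ-≢ : ∀ {a b} → a ≢ b → δ a b ≡ 1
δ-≢ {a} {b} a≢b with a ≡ᵇ b in e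
... | true = ⊥-elim (a≢b (≡ᵇ⇒≡ a b (subst T (sym e) _)))
... | false = refl

δ≡0⇒≡ : ∀ {a b} → δ a b ≡ 0 → a ≡ b
δ≡0⇒≡ {a} {b} z with a ≡ᵇ b in e
... | true = ≡ᵇ⇒≡ a b (subst T (sym e) _)

δ≢0⇒≢ : ∀ {a b} → δ a b ≢ 0 → a ≢ b
δ≢0⇒≢ {a} ne refl = ne (δ-≡ a)

δ≤1 : ∀ a b → δ a b ≤ 1
δ≤1 a b with a ≡ᵇ b
... | true = z≤n
... | false = s≤s z≤n

δ-sym : ∀ a b → δ a b ≡ δ b a
δ-sym a b with a ≟ b
... | yes refl = refl
... | no a≢b = trans (δ-≢ a≢b) (sym (δ-≢ (a≢b ∘ sym)))

δ-+ʳ : ∀ k l a → δ (k + a) (l + a) ≡ δ k l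
δ-+ʳ k l a with k ≟ l
... | yes refl = trans (δ-≡ (k + a)) (sym (δ-≡ k))
... | no k≢l = trans (δ-≢ (k≢l ∘ +-cancelʳ-≡ a k l)) (sym (δ-≢ k≢l))

Δ : ∀ {m} → (Fin m → ℕ) → (Fin m → ℕ) → Fin m → ℕ
Δ h k i = δ (h i) (k i)

Adjᶠ : ∀ {m} → (Fin m → ℕ) → (Fin m → ℕ) → Set
Adjᶠ h k = ∑ (Δ h k) ≡ 2

diffCount≡∑Δ : ∀ {m} (u v : Vec ℕ m) → diffCount u v ≡ ∑ (Δ (lookup u) (lookup v))
diffCount≡∑Δ [] [] = refl
diffCount≡∑Δ (a ∷ u) (b ∷ v) = cong (δ a b +_) (diffCount≡∑Δ u v)

diffCount-self : ∀ {m} (u : Vec ℕ m) → diffCount u u ≡ 0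
diffCount-self u = trans (diffCount≡∑Δ u u) (∑-zero (λ i → δ-≡ (lookup u i)))

Adj⇒Adjᶠ : ∀ {m n} {u v : Vertex m n} → Adj u v → Adjᶠ ⟦ u ⟧ ⟦ v ⟧
Adj⇒Adjᶠ {u = u} {v} a = trans (sym (diffCount≡∑Δ (proj₁ u) (proj₁ v))) a

Adjᶠ⇒Adj : ∀ {m n} {u v : Vertex m n} → Adjᶠ ⟦ u ⟧ ⟦ v ⟧ → Adj u v
Adjᶠ⇒Adj {u = u} {v} a = trans (diffCount≡∑Δ (proj₁ u) (proj₁ v)) a

Adjᶠ-cong : ∀ {m} {h h′ k k′ : Fin m → ℕ} → (∀ i → h i ≡ h′ i) → (∀ i → k i ≡ k′ i) → Adjᶠ h k → Adjᶠ h′ k′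
Adjᶠ-cong h≗h′ k≗k′ a = trans (∑-cong (λ i → sym (cong₂ δ (h≗h′ i) (k≗k′ i)))) a

Adjᶠ-sym : ∀ {m} {h k : Fin m → ℕ} → Adjᶠ h k → Adjᶠ k h
Adjᶠ-sym {h = h} {k} a = trans (∑-cong (λ i → δ-sym (k i) (h i))) a

record Differ₂ {m} (h k : Fin m → ℕ) : Set where
  constructor differ₂
  field
    p q : Fin m
    p≢q : p ≢ q
    at-p : h p ≢ k p
    at-q : h q ≢ k q
    elsewhere : ∀ r → r ≢ p → r ≢ q → h r ≡ k r

Differ₂⇒Adjᶠ : ∀ {m} {h k : Fin m → ℕ} → Differ₂ h k → Adjᶠ h k
Differ₂⇒Adjᶠ {h = h} {k} (differ₂ p q p≢q at-p at-q elsewhere) =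
  trans (∑-two (Δ h k) p≢q (λ r r≢p r≢q → trans (cong (δ (h r)) (sym (elsewhere r r≢p r≢q))) (δ-≡ (h r))))
        (cong₂ _+_ (δ-≢ at-p) (δ-≢ at-q))

Adjᶠ⇒Differ₂ : ∀ {m} {h k : Fin m → ℕ} → Adjᶠ h k → Differ₂ h k
Adjᶠ⇒Differ₂ {h = h} {k} a = withFirst (∑-nonzero D (λ e → 2≢0 (trans (sym a) e)))
  where
  D = Δ h k
  2≢0 : 2 ≢ 0
  2≢0 ()
  1≢0 : 1 ≢ 0
  1≢0 ()
  withFirst : (∃ λ p → D p ≢ 0) → Differ₂ h k
  withFirst (p , Dp≢0) = withSecond (∑-nonzero (D [ p ]≔ 0) (λ e → 1≢0 (trans (sym ∑Dₚ≡1) e)))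
    where
    ∑Dₚ≡1 : ∑ (D [ p ]≔ 0) ≡ 1
    ∑Dₚ≡1 = +-cancelˡ-≡ 1 (∑ (D [ p ]≔ 0)) 1 (trans (cong (_+ ∑ (D [ p ]≔ 0)) (sym (δ-≢ (δ≢0⇒≢ {h p} {k p} Dp≢0)))) (trans (sym (∑-split p D)) a))
    withSecond : (∃ λ q → (D [ p ]≔ 0) q ≢ 0) → Differ₂ h k
    withSecond (q , Dₚq≢0) = differ₂ p q p≢q (δ≢0⇒≢ {h p} {k p} Dp≢0) (δ≢0⇒≢ {h q} {k q} Dq≢0) elsewhere
      where
      p≢q : p ≢ q
      p≢q refl = Dₚq≢0 (≔-same D p 0)
      Dₚq≡Dq : (D [ p ]≔ 0) q ≡ D q
      Dₚq≡Dq = ≔-other D 0 (p≢q ∘ sym)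
      Dq≢0 : D q ≢ 0
      Dq≢0 e = Dₚq≢0 (trans Dₚq≡Dq e)
      rest≡0 : ∑ (D [ p ]≔ 0 [ q ]≔ 0) ≡ 0
      rest≡0 = +-cancelˡ-≡ 1 (∑ (D [ p ]≔ 0 [ q ]≔ 0)) 0 (trans (cong (_+ ∑ (D [ p ]≔ 0 [ q ]≔ 0)) (sym (trans Dₚq≡Dq (δ-≢ (δ≢0⇒≢ {h q} {k q} Dq≢0)))))
                                        (trans (sym (∑-split q (D [ p ]≔ 0))) ∑Dₚ≡1))
      elsewhere : ∀ r → r ≢ p → r ≢ q → h r ≡ k r
      elsewhere r r≢p r≢q = δ≡0⇒≡ (trans (sym (trans (≔-other (D [ p ]≔ 0) 0 r≢q) (≔-other D 0 r≢p))) (∑≡0⇒coord≡0 (D [ p ]≔ 0 [ q ]≔ 0) rest≡0 r))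

Differ₂-no-third : ∀ {m} {h k : Fin m → ℕ} → Differ₂ h k → (a b c : Fin m) → a ≢ b → a ≢ c → b ≢ c →
                   h a ≢ k a → h b ≢ k b → h c ≢ k c → ⊥
Differ₂-no-third {h = h} {k} (differ₂ p q _ _ _ elsewhere) a b c a≢b a≢c b≢c da db dc =
  pigeon (where? a da) (where? b db) (where? c dc)
  where
  where? : ∀ r → h r ≢ k r → (r ≡ p) ⊎ (r ≡ q)
  where? r d = fin-cases r p inj₁ (λ r≢p → fin-cases r q inj₂ (λ r≢q → ⊥-elim (d (elsewhere r r≢p r≢q))))
  pigeon : (a ≡ p) ⊎ (a ≡ q) → (b ≡ p) ⊎ (b ≡ q) → (c ≡ p) ⊎ (c ≡ q) → ⊥
  pigeon (inj₁ refl) (inj₁ refl) _ = a≢b refl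
  pigeon (inj₂ refl) (inj₂ refl) _ = a≢b refl
  pigeon (inj₁ refl) _ (inj₁ refl) = a≢c refl
  pigeon (inj₂ refl) _ (inj₂ refl) = a≢c refl
  pigeon _ (inj₁ refl) (inj₁ refl) = b≢c refl
  pigeon _ (inj₂ refl) (inj₂ refl) = b≢c refl

three-differences : ∀ {m n} {x y : Vertex m n} {a b c : Fin m} → a ≢ b → a ≢ c → b ≢ c →
  ⟦ x ⟧ a ≢ ⟦ y ⟧ a → ⟦ x ⟧ b ≢ ⟦ y ⟧ b → ⟦ x ⟧ c ≢ ⟦ y ⟧ c → ¬ Adj x y
three-differences {x = x} {y} a≢b a≢c b≢c da db dc x~y =
  Differ₂-no-third (Adjᶠ⇒Differ₂ (Adj⇒Adjᶠ {u = x} {v = y} x~y)) _ _ _ a≢b a≢c b≢c da db dc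

-- Corners have no claw,
-- every other vertex has one (for n > 2 and m > 2), so automorphisms preserve corners.
record Claw {m n} (v : Vertex m n) : Set where
  constructor claw
  field
    x y₁ y₂ y₃ : Vertex m n
    v~x : Adj v x
    v~y₁ : Adj v y₁
    v~y₂ : Adj v y₂
    v~y₃ : Adj v y₃
    x~y₁ : Adj x y₁
    x~y₂ : Adj x y₂
    x~y₃ : Adj x y₃
    y₁≁y₂ : ¬ Adj y₁ y₂
    y₁≁y₃ : ¬ Adj y₁ y₃
    y₂≁y₃ : ¬ Adj y₂ y₃
    y₁≢y₂ : y₁ ≢ y₂
    y₁≢y₃ : y₁ ≢ y₃
    y₂≢y₃ : y₂ ≢ y₃

Pattern : Set
Pattern = ℕ × ℕ × ℕ

total : Pattern → ℕ
total (p₁ , p₂ , p₃) = p₁ + p₂ + p₃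

diff : Pattern → Pattern → ℕ
diff (p₁ , p₂ , p₃) (q₁ , q₂ , q₃) = δ p₁ q₁ + δ p₂ q₂ + δ p₃ q₃

regroup : ∀ p₁ p₂ p₃ a b c → p₁ + a + (p₂ + b) + (p₃ + c) ≡ p₁ + p₂ + p₃ + (a + b + c)
regroup = solve-∀

-- Vertices obtained from v by placing the pattern p, shifted by (a , b , c), at the
-- distinct positions i j k.  Adjacency among them is decided by the patterns alone.
module Shapes {m n} (v : Vertex m n) {i j k : Fin m} (i≢j : i ≢ j) (i≢k : i ≢ k) (j≢k : j ≢ k) (a b c : ℕ) where

  shape : Pattern → Fin m → ℕ
  shape (p₁ , p₂ , p₃) = ⟦ v ⟧ [ i ]≔ p₁ + a [ j ]≔ p₂ + b [ k ]≔ p₃ + c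

  shape-i : ∀ p → shape p i ≡ proj₁ p + a
  shape-i p = trans (≔-other _ _ i≢k) (trans (≔-other _ _ i≢j) (≔-same _ i _))

  shape-j : ∀ p → shape p j ≡ proj₁ (proj₂ p) + b
  shape-j p = trans (≔-other _ _ j≢k) (≔-same _ j _)

  shape-k : ∀ p → shape p k ≡ proj₂ (proj₂ p) + c
  shape-k p = ≔-same _ k _

  shape-other : ∀ p {r} → r ≢ i → r ≢ j → r ≢ k → shape p r ≡ ⟦ v ⟧ r
  shape-other p r≢i r≢j r≢k = trans (≔-other _ _ r≢k) (trans (≔-other _ _ r≢j) (≔-other _ _ r≢i))

  ∑Δ-shape : ∀ p q → ∑ (Δ (shape p) (shape q)) ≡ diff p q
  ∑Δ-shape p@(p₁ , p₂ , p₃) q@(q₁ , q₂ , q₃) = begin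
    ∑ (Δ (shape p) (shape q))
      ≡⟨ ∑-three (Δ (shape p) (shape q)) i≢j i≢k j≢k outside ⟩
    Δ (shape p) (shape q) i + Δ (shape p) (shape q) j + Δ (shape p) (shape q) k
      ≡⟨ cong₂ _+_ (cong₂ _+_ (cong₂ δ (shape-i p) (shape-i q)) (cong₂ δ (shape-j p) (shape-j q)))
                   (cong₂ δ (shape-k p) (shape-k q)) ⟩
    δ (p₁ + a) (q₁ + a) + δ (p₂ + b) (q₂ + b) + δ (p₃ + c) (q₃ + c)
      ≡⟨ cong₂ _+_ (cong₂ _+_ (δ-+ʳ p₁ q₁ a) (δ-+ʳ p₂ q₂ b)) (δ-+ʳ p₃ q₃ c) ⟩
    diff p q ∎
    where
    open ≡-Reasoning
    outside : ∀ r → r ≢ i → r ≢ j → r ≢ k → Δ (shape p) (shape q) r ≡ 0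
    outside r r≢i r≢j r≢k = trans (cong₂ δ (shape-other p r≢i r≢j r≢k) (shape-other q r≢i r≢j r≢k)) (δ-≡ (⟦ v ⟧ r))

  has-shape : ∀ c₀ → ⟦ v ⟧ i ≡ proj₁ c₀ + a → ⟦ v ⟧ j ≡ proj₁ (proj₂ c₀) + b → ⟦ v ⟧ k ≡ proj₂ (proj₂ c₀) + c →
              ∀ r → ⟦ v ⟧ r ≡ shape c₀ r
  has-shape c₀ vi vj vk r =
    fin-cases r i (λ { refl → trans vi (sym (shape-i c₀)) }) λ r≢i →
    fin-cases r j (λ { refl → trans vj (sym (shape-j c₀)) }) λ r≢j →
    fin-cases r k (λ { refl → trans vk (sym (shape-k c₀)) }) λ r≢k →
    sym (shape-other c₀ r≢i r≢j r≢k)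

  module _ (c₀ : Pattern) (v-shape : ∀ r → ⟦ v ⟧ r ≡ shape c₀ r) where

    ∑-shape : ∀ p → total p ≡ total c₀ → ∑ (shape p) ≡ n
    ∑-shape p@(p₁ , p₂ , p₃) e = trans (∑-agree₃ (shape p) (shape c₀) i≢j i≢k j≢k
        (λ r r≢i r≢j r≢k → trans (shape-other p r≢i r≢j r≢k) (sym (shape-other c₀ r≢i r≢j r≢k))) on-ijk)
      (trans (∑-cong (λ r → sym (v-shape r))) ∑⟦ v ⟧)
      where
      open ≡-Reasoning
      c₁ = proj₁ c₀
      c₂ = proj₁ (proj₂ c₀)
      c₃ = proj₂ (proj₂ c₀)
      on-ijk : shape p i + shape p j + shape p k ≡ shape c₀ i + shape c₀ j + shape c₀ k
      on-ijk = begin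
        shape p i + shape p j + shape p k
          ≡⟨ cong₂ _+_ (cong₂ _+_ (shape-i p) (shape-j p)) (shape-k p) ⟩
        p₁ + a + (p₂ + b) + (p₃ + c)         ≡⟨ regroup p₁ p₂ p₃ a b c ⟩
        total p + (a + b + c)                ≡⟨ cong (_+ (a + b + c)) e ⟩
        total c₀ + (a + b + c)               ≡⟨ regroup c₁ c₂ c₃ a b c ⟨
        c₁ + a + (c₂ + b) + (c₃ + c)         ≡⟨ cong₂ _+_ (cong₂ _+_ (shape-i c₀) (shape-j c₀)) (shape-k c₀) ⟨
        shape c₀ i + shape c₀ j + shape c₀ k ∎

    vertexOf : (p : Pattern) → total p ≡ total c₀ → Vertex m n
    vertexOf p e = mkV (shape p) (∑-shape p e)

    private
      adj-v : ∀ p e → diff c₀ p ≡ 2 → Adj v (vertexOf p e)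
      adj-v p e d = Adjᶠ⇒Adj {u = v} {v = vertexOf p e}
        (Adjᶠ-cong (λ r → sym (v-shape r)) (λ r → sym (mkV-at (shape p) (∑-shape p e) r)) (trans (∑Δ-shape c₀ p) d))

      ∑Δ-vertexOf : ∀ p q e e′ → diffCount (proj₁ (vertexOf p e)) (proj₁ (vertexOf q e′)) ≡ diff p q
      ∑Δ-vertexOf p q e e′ = trans (diffCount≡∑Δ (proj₁ (vertexOf p e)) (proj₁ (vertexOf q e′)))
        (trans (∑-cong (λ r → cong₂ δ (mkV-at (shape p) (∑-shape p e) r) (mkV-at (shape q) (∑-shape q e′) r))) (∑Δ-shape p q))

      adj : ∀ p q e e′ → diff p q ≡ 2 → Adj (vertexOf p e) (vertexOf q e′)
      adj p q e e′ d = trans (∑Δ-vertexOf p q e e′) d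

      far : ∀ p q e e′ → diff p q ≡ 3 → ¬ Adj (vertexOf p e) (vertexOf q e′) × vertexOf p e ≢ vertexOf q e′
      far p q e e′ d = (λ a → 3≢2 (trans 3≡diffCount a)) , (λ eq → 3≢0 (trans 3≡diffCount (trans (cong (diffCount P ∘ proj₁) (sym eq)) (diffCount-self P))))
        where
        P = proj₁ (vertexOf p e)
        3≡diffCount : 3 ≡ diffCount P (proj₁ (vertexOf q e′))
        3≡diffCount = trans (sym d) (sym (∑Δ-vertexOf p q e e′))
        3≢2 : 3 ≢ 2
        3≢2 ()
        3≢0 : 3 ≢ 0
        3≢0 ()

    patternClaw : (x y₁ y₂ y₃ : Pattern) →
      (ex : total x ≡ total c₀) (e₁ : total y₁ ≡ total c₀) (e₂ : total y₂ ≡ total c₀) (e₃ : total y₃ ≡ total c₀) →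
      diff c₀ x ≡ 2 → diff c₀ y₁ ≡ 2 → diff c₀ y₂ ≡ 2 → diff c₀ y₃ ≡ 2 →
      diff x y₁ ≡ 2 → diff x y₂ ≡ 2 → diff x y₃ ≡ 2 →
      diff y₁ y₂ ≡ 3 → diff y₁ y₃ ≡ 3 → diff y₂ y₃ ≡ 3 → Claw v
    patternClaw x y₁ y₂ y₃ ex e₁ e₂ e₃ dx d₁ d₂ d₃ dx₁ dx₂ dx₃ d₁₂ d₁₃ d₂₃ =
      claw (vertexOf x ex) (vertexOf y₁ e₁) (vertexOf y₂ e₂) (vertexOf y₃ e₃)
        (adj-v x ex dx) (adj-v y₁ e₁ d₁) (adj-v y₂ e₂ d₂) (adj-v y₃ e₃ d₃)
        (adj x y₁ ex e₁ dx₁) (adj x y₂ ex e₂ dx₂) (adj x y₃ ex e₃ dx₃)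
        (proj₁ f₁₂) (proj₁ f₁₃) (proj₁ f₂₃) (proj₂ f₁₂) (proj₂ f₁₃) (proj₂ f₂₃)
      where
      f₁₂ = far y₁ y₂ e₁ e₂ d₁₂
      f₁₃ = far y₁ y₃ e₁ e₃ d₁₃
      f₂₃ = far y₂ y₃ e₂ e₃ d₂₃

-- The two claw configurations: a coordinate ≥ 2 next to a coordinate ≥ 1,
-- or three coordinates ≥ 1.  All conditions are checked on the patterns.
claw-2-1 : ∀ {m n} (v : Vertex m n) {i j k : Fin m} → i ≢ j → i ≢ k → j ≢ k → ∀ {a b} →
           ⟦ v ⟧ i ≡ 2 + a → ⟦ v ⟧ j ≡ 1 + b → Claw v
claw-2-1 v {k = k} i≢j i≢k j≢k {a} {b} vi vj =
  patternClaw c₀ (has-shape c₀ vi vj refl) (1 , 1 , 1) (2 , 0 , 1) (1 , 2 , 0) (0 , 1 , 2)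
    refl refl refl refl refl refl refl refl refl refl refl refl refl refl
  where
  open Shapes v i≢j i≢k j≢k a b (⟦ v ⟧ k)
  c₀ : Pattern
  c₀ = 2 , 1 , 0

claw-1-1-1 : ∀ {m n} (v : Vertex m n) {i j k : Fin m} → i ≢ j → i ≢ k → j ≢ k → ∀ {a b c} →
             ⟦ v ⟧ i ≡ 1 + a → ⟦ v ⟧ j ≡ 1 + b → ⟦ v ⟧ k ≡ 1 + c → Claw v
claw-1-1-1 v i≢j i≢k j≢k {a} {b} {c} vi vj vk =
  patternClaw c₀ (has-shape c₀ vi vj vk) (0 , 1 , 2) (1 , 0 , 2) (0 , 2 , 1) (2 , 1 , 0)
    refl refl refl refl refl refl refl refl refl refl refl refl refl refl
  where
  open Shapes v i≢j i≢k j≢k a b c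
  c₀ : Pattern
  c₀ = 1 , 1 , 1

ThirdPosition : ℕ → Set
ThirdPosition m = (i j : Fin m) → ∃ λ k → k ≢ i × k ≢ j

private
  avoid-2 : ∀ {m} {i j : Fin (3 + m)} → (zero ≡ i ⊎ zero ≡ j) → (suc zero ≡ i ⊎ suc zero ≡ j) →
            suc (suc zero) ≢ i × suc (suc zero) ≢ j
  avoid-2 (inj₁ refl) (inj₂ refl) = (λ ()) , (λ ())
  avoid-2 (inj₂ refl) (inj₁ refl) = (λ ()) , (λ ())
  avoid-2 (inj₁ refl) (inj₁ ())
  avoid-2 (inj₂ refl) (inj₂ ())

third-position : ∀ {m} → 2 < m → ThirdPosition m
third-position {suc (suc zero)} (s≤s (s≤s ()))
third-position {suc (suc (suc m))} _ i j with try zero | try (suc zero)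
  where
  try : (k : Fin (3 + m)) → (k ≡ i ⊎ k ≡ j) ⊎ (k ≢ i × k ≢ j)
  try k = fin-cases k i (inj₁ ∘ inj₁) λ k≢i → fin-cases k j (inj₁ ∘ inj₂) λ k≢j → inj₂ (k≢i , k≢j)
... | inj₂ avoids | _ = zero , avoids
... | inj₁ _ | inj₂ avoids = suc zero , avoids
... | inj₁ h₀ | inj₁ h₁ = suc (suc zero) , avoid-2 h₀ h₁

nonzero-suc : ∀ {x} → x ≢ 0 → ∃ λ y → x ≡ suc y
nonzero-suc {zero} x≢0 = ⊥-elim (x≢0 refl)
nonzero-suc {suc y} _ = y , refl

-- A vertex with two nonzero coordinates carries a claw: either one of them is at
-- least 2, or (as n > 2) a third coordinate is nonzero.
two-positions-claw : ∀ {m n} → 2 < n → ThirdPosition m → (v : Vertex m n) {i j : Fin m} → i ≢ j →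
                     ⟦ v ⟧ i ≢ 0 → ⟦ v ⟧ j ≢ 0 → Claw v
two-positions-claw {m} {n} n>2 third v {i} {j} i≢j hᵢ≢0 hⱼ≢0 = bySize (nonzero-suc hᵢ≢0) (nonzero-suc hⱼ≢0)
  where
  h = ⟦ v ⟧
  k = proj₁ (third i j)
  i≢k : i ≢ k
  i≢k = proj₁ (proj₂ (third i j)) ∘ sym
  j≢k : j ≢ k
  j≢k = proj₂ (proj₂ (third i j)) ∘ sym
  bySize : (∃ λ a → h i ≡ suc a) → (∃ λ b → h j ≡ suc b) → Claw v
  bySize (suc a , hᵢ) (b , hⱼ) = claw-2-1 v i≢j i≢k j≢k hᵢ hⱼ
  bySize (zero , hᵢ) (suc b , hⱼ) = claw-2-1 v (i≢j ∘ sym) j≢k i≢k hⱼ hᵢ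
  bySize (zero , hᵢ) (zero , hⱼ) = withThird (∑-nonzero rest (λ e → <-irrefl (sym (n≡2 e)) n>2))
    where
    rest = h [ i ]≔ 0 [ j ]≔ 0
    n≡2 : ∑ rest ≡ 0 → n ≡ 2
    n≡2 e = trans (sym ∑⟦ v ⟧) (trans (∑-split₂ h i≢j) (cong₂ _+_ (cong₂ _+_ hᵢ hⱼ) e))
    withThird : (∃ λ l → rest l ≢ 0) → Claw v
    withThird (l , rest-l≢0) = claw-1-1-1 v i≢j i≢l j≢l hᵢ hⱼ (proj₂ (nonzero-suc hₗ≢0))
      where
      j≢l : j ≢ l
      j≢l refl = rest-l≢0 (≔-same _ j 0)
      i≢l : i ≢ l
      i≢l refl = rest-l≢0 (trans (≔-other _ 0 i≢j) (≔-same h i 0))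
      hₗ≢0 : h l ≢ 0
      hₗ≢0 e = rest-l≢0 (trans (≔-other _ 0 (j≢l ∘ sym)) (trans (≔-other h 0 (i≢l ∘ sym)) e))

-- Every vertex that is not a corner has two nonzero coordinates, hence a claw.
nonCorner-claw : ∀ {m n} → 2 < n → ThirdPosition m → (v : Vertex m n) → (∀ i → ⟦ v ⟧ i ≢ n) → Claw v
nonCorner-claw {m} {n} n>2 third v not-corner = withFirst (∑-nonzero h (λ e → m<n⇒n≢0 n>2 (trans (sym ∑⟦ v ⟧) e)))
  where
  h = ⟦ v ⟧
  withFirst : (∃ λ i → h i ≢ 0) → Claw v
  withFirst (i , hᵢ≢0) = withSecond (∑-nonzero (h [ i ]≔ 0) rest≢0)
    where
    rest≢0 : ∑ (h [ i ]≔ 0) ≢ 0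
    rest≢0 e = not-corner i (trans (sym (+-identityʳ (h i))) (trans (cong (h i +_) (sym e)) (trans (sym (∑-split i h)) ∑⟦ v ⟧)))
    withSecond : (∃ λ j → (h [ i ]≔ 0) j ≢ 0) → Claw v
    withSecond (j , rest-j≢0) = two-positions-claw n>2 third v i≢j hᵢ≢0 (λ e → rest-j≢0 (trans (≔-other h 0 (i≢j ∘ sym)) e))
      where
      i≢j : i ≢ j
      i≢j refl = rest-j≢0 (≔-same h i 0)

private
  cornerᶠ : ∀ {m} → ℕ → Fin m → Fin m → ℕ
  cornerᶠ n i = (λ _ → 0) [ i ]≔ n

  ∑cornerᶠ : ∀ {m} n (i : Fin m) → ∑ (cornerᶠ n i) ≡ n
  ∑cornerᶠ n i = trans (∑-point i _ (λ j j≢i → ≔-other _ n j≢i)) (≔-same _ i n)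

corner : ∀ {m n} → Fin m → Vertex m n
corner {n = n} i = mkV (cornerᶠ n i) (∑cornerᶠ n i)

corner-at : ∀ {m n} (i : Fin m) → ⟦ corner {n = n} i ⟧ i ≡ n
corner-at {n = n} i = trans (mkV-at (cornerᶠ n i) (∑cornerᶠ n i) i) (≔-same _ i n)

corner-off : ∀ {m n} {i r : Fin m} → r ≢ i → ⟦ corner {n = n} i ⟧ r ≡ 0
corner-off {n = n} {i} {r} r≢i = trans (mkV-at (cornerᶠ n i) (∑cornerᶠ n i) r) (≔-other _ n r≢i)

IsCorner : ∀ {m n} → Vertex m n → Set
IsCorner {m} {n} v = ∃ λ (i : Fin m) → ⟦ v ⟧ i ≡ n

isCorner? : ∀ {m n} (v : Vertex m n) → Dec (IsCorner v)
isCorner? {n = n} v = any? (λ i → ⟦ v ⟧ i ≟ n)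

full-coordinate : ∀ {m n} (c : Fin m → ℕ) {i} → ∑ c ≡ n → c i ≡ n → ∀ r → r ≢ i → c r ≡ 0
full-coordinate c {i} ∑c≡n cᵢ≡n r r≢i = trans (sym (≔-other c 0 r≢i))
  (∑≡0⇒coord≡0 (c [ i ]≔ 0) (+-cancelˡ-≡ (c i) _ 0 (trans (sym (∑-split i c)) (trans ∑c≡n (trans (sym cᵢ≡n) (sym (+-identityʳ (c i))))))) r)

≡corner : ∀ {m n} (v : Vertex m n) {i} → ⟦ v ⟧ i ≡ n → v ≡ corner i
≡corner v {i} vᵢ≡n = vertex-ext λ r → fin-cases r i
  (λ { refl → trans vᵢ≡n (sym (corner-at r)) })
  (λ r≢i → trans (full-coordinate ⟦ v ⟧ ∑⟦ v ⟧ vᵢ≡n r r≢i) (sym (corner-off r≢i)))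

corner-unique : ∀ {m n} → n ≢ 0 → (v : Vertex m n) {a b : Fin m} → ⟦ v ⟧ a ≡ n → ⟦ v ⟧ b ≡ n → a ≡ b
corner-unique n≢0 v {a} {b} vₐ≡n v_b≡n = fin-cases a b (λ a≡b → a≡b)
  (λ a≢b → ⊥-elim (n≢0 (trans (sym v_b≡n) (full-coordinate ⟦ v ⟧ ∑⟦ v ⟧ vₐ≡n b (a≢b ∘ sym)))))

record CornerNeighbour {m} (n : ℕ) (i : Fin m) (u : Fin m → ℕ) : Set where
  constructor cornerNeighbour
  field
    line : Fin m
    line≢i : line ≢ i
    off-line : ∀ l → l ≢ i → l ≢ line → u l ≡ 0
    value≢0 : u line ≢ 0
    split-n : u i + u line ≡ n

cornerNeighbour-of : ∀ {m n} (c u : Fin m → ℕ) {i} → ∑ c ≡ n → c i ≡ n → ∑ u ≡ n → Adjᶠ c u → CornerNeighbour n i u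
cornerNeighbour-of {n = n} c u {i} ∑c ∑cᵢ ∑u a with Adjᶠ⇒Differ₂ a
... | differ₂ p q p≢q at-p at-q elsewhere =
  fin-cases p i (λ { refl → build q (p≢q ∘ sym) (λ l l≢i l≢q → elsewhere l l≢i l≢q) at-q }) λ p≢i →
  fin-cases q i (λ { refl → build p p≢i (λ l l≢i l≢p → elsewhere l l≢p l≢i) at-p }) λ q≢i →
  ⊥-elim (too-big p≢i (elsewhere i (p≢i ∘ sym) (q≢i ∘ sym)))
  where
  c-off : ∀ r → r ≢ i → c r ≡ 0
  c-off = full-coordinate c ∑c ∑cᵢ
  build : ∀ j → j ≢ i → (∀ l → l ≢ i → l ≢ j → c l ≡ u l) → c j ≢ u j → CornerNeighbour n i u
  build j j≢i agree at-j = cornerNeighbour j j≢i u-off (λ e → at-j (trans (c-off j j≢i) (sym e)))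
    (trans (sym (∑-two u (j≢i ∘ sym) u-off)) ∑u)
    where
    u-off : ∀ l → l ≢ i → l ≢ j → u l ≡ 0
    u-off l l≢i l≢j = trans (sym (agree l l≢i l≢j)) (c-off l l≢i)
  -- if i is not a changed position, u keeps cᵢ = n and has a further nonzero value
  too-big : p ≢ i → c i ≡ u i → ⊥
  too-big p≢i cᵢ≡uᵢ = <⇒≱ n<uᵢ+uₚ (subst (u i + u p ≤_) ∑u (coords≤∑ u (p≢i ∘ sym)))
    where
    n<uᵢ+uₚ : n < u i + u p
    n<uᵢ+uₚ = subst (_< u i + u p) (trans (+-identityʳ (u i)) (trans (sym cᵢ≡uᵢ) ∑cᵢ))
                (+-monoʳ-< (u i) (n≢0⇒n>0 (λ e → at-p (trans (c-off p p≢i) (sym e)))))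

-- Two neighbours of a corner share a line or a value; the neighbourhood of a
-- corner is a rook's graph, in which such sharing is exactly adjacency.
Shares : ∀ {m n} {i : Fin m} {u w : Fin m → ℕ} → CornerNeighbour n i u → CornerNeighbour n i w → Set
Shares {u = u} {w = w} U W = (CornerNeighbour.line U ≡ CornerNeighbour.line W) ⊎ (u (CornerNeighbour.line U) ≡ w (CornerNeighbour.line W))

module _ {m n} {i : Fin m} {u w : Fin m → ℕ} (U : CornerNeighbour n i u) (W : CornerNeighbour n i w) where
  open CornerNeighbour U renaming (line to P; line≢i to P≢i; off-line to u-off; value≢0 to uₚ≢0; split-n to u-split)
  open CornerNeighbour W renaming (line to Q; line≢i to Q≢i; off-line to w-off; value≢0 to w_q≢0; split-n to w-split)

  private
    same-at-i : u P ≡ w Q → u i ≡ w i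
    same-at-i e = +-cancelʳ-≡ (u P) (u i) (w i) (trans u-split (sym (trans (cong (w i +_) e) w-split)))

    differ-at-i : u P ≢ w Q → u i ≢ w i
    differ-at-i ne e = ne (+-cancelˡ-≡ (u i) (u P) (w Q) (trans u-split (sym (trans (cong (_+ w Q) e) w-split))))

    i≢P : i ≢ P
    i≢P = P≢i ∘ sym

    w-off-P : P ≢ Q → w P ≡ 0
    w-off-P P≢Q = w-off P P≢i P≢Q

    u-off-Q : P ≢ Q → u Q ≡ 0
    u-off-Q P≢Q = u-off Q Q≢i (P≢Q ∘ sym)

  shares⇒adj : ¬ (∀ r → u r ≡ w r) → Shares U W → Adjᶠ u w
  shares⇒adj distinct (inj₁ refl) with u P ≟ w P
  ... | yes e = ⊥-elim (distinct λ r → fin-cases r i (λ { refl → same-at-i e }) λ r≢i →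
                  fin-cases r P (λ { refl → e }) λ r≢P → trans (u-off r r≢i r≢P) (sym (w-off r r≢i r≢P)))
  ... | no ne = Differ₂⇒Adjᶠ (differ₂ i P i≢P (differ-at-i ne) ne
                  (λ r r≢i r≢P → trans (u-off r r≢i r≢P) (sym (w-off r r≢i r≢P))))
  shares⇒adj distinct (inj₂ e) = fin-cases P Q same-line different-lines
    where
    same-line : P ≡ Q → Adjᶠ u w
    same-line refl = ⊥-elim (distinct λ r → fin-cases r i (λ { refl → same-at-i e }) λ r≢i →
                       fin-cases r P (λ { refl → e }) λ r≢P → trans (u-off r r≢i r≢P) (sym (w-off r r≢i r≢P)))
    different-lines : P ≢ Q → Adjᶠ u w
    different-lines P≢Q = Differ₂⇒Adjᶠ (differ₂ P Q P≢Q (λ x → uₚ≢0 (trans x (w-off-P P≢Q)))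
      (λ x → w_q≢0 (trans (sym x) (u-off-Q P≢Q)))
      (λ r r≢P r≢Q → fin-cases r i (λ { refl → same-at-i e }) λ r≢i → trans (u-off r r≢i r≢P) (sym (w-off r r≢i r≢Q))))

  adj⇒shares : Adjᶠ u w → Shares U W
  adj⇒shares a = fin-cases P Q inj₁ λ P≢Q → by-value P≢Q (u P ≟ w Q)
    where
    by-value : P ≢ Q → Dec (u P ≡ w Q) → Shares U W
    by-value _ (yes e) = inj₂ e
    by-value P≢Q (no ne) = ⊥-elim (Differ₂-no-third (Adjᶠ⇒Differ₂ a) i P Q i≢P (Q≢i ∘ sym) P≢Q
      (differ-at-i ne) (λ x → uₚ≢0 (trans x (w-off-P P≢Q))) (λ x → w_q≢0 (trans (sym x) (u-off-Q P≢Q))))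

pigeonhole : ∀ {m n} {i : Fin m} {x y₁ y₂ y₃ : Fin m → ℕ}
             (X : CornerNeighbour n i x) (Y₁ : CornerNeighbour n i y₁) (Y₂ : CornerNeighbour n i y₂) (Y₃ : CornerNeighbour n i y₃) →
             Shares X Y₁ → Shares X Y₂ → Shares X Y₃ → Shares Y₁ Y₂ ⊎ Shares Y₁ Y₃ ⊎ Shares Y₂ Y₃
pigeonhole _ _ _ _ (inj₁ e₁) (inj₁ e₂) _ = inj₁ (inj₁ (trans (sym e₁) e₂))
pigeonhole _ _ _ _ (inj₂ e₁) (inj₂ e₂) _ = inj₁ (inj₂ (trans (sym e₁) e₂))
pigeonhole _ _ _ _ (inj₁ e₁) (inj₂ _) (inj₁ e₃) = inj₂ (inj₁ (inj₁ (trans (sym e₁) e₃)))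
pigeonhole _ _ _ _ (inj₂ e₁) (inj₁ _) (inj₂ e₃) = inj₂ (inj₁ (inj₂ (trans (sym e₁) e₃)))
pigeonhole _ _ _ _ (inj₁ _) (inj₂ e₂) (inj₂ e₃) = inj₂ (inj₂ (inj₂ (trans (sym e₂) e₃)))
pigeonhole _ _ _ _ (inj₂ _) (inj₁ e₂) (inj₁ e₃) = inj₂ (inj₂ (inj₁ (trans (sym e₂) e₃)))

corner-no-claw : ∀ {m n} (c : Vertex m n) {i} → ⟦ c ⟧ i ≡ n → ¬ Claw c
corner-no-claw {m} {n} c {i} cᵢ≡n (claw x y₁ y₂ y₃ c~x c~y₁ c~y₂ c~y₃ x~y₁ x~y₂ x~y₃ y₁≁y₂ y₁≁y₃ y₂≁y₃ y₁≢y₂ y₁≢y₃ y₂≢y₃) =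
  conclude (pigeonhole X Y₁ Y₂ Y₃ (adj⇒shares X Y₁ (asᶠ {x} {y₁} x~y₁)) (adj⇒shares X Y₂ (asᶠ {x} {y₂} x~y₂)) (adj⇒shares X Y₃ (asᶠ {x} {y₃} x~y₃)))
  where
  asᶠ : ∀ {a b : Vertex m n} → Adj a b → Adjᶠ ⟦ a ⟧ ⟦ b ⟧
  asᶠ {a} {b} = Adj⇒Adjᶠ {u = a} {v = b}
  neighbour : ∀ {u} → Adj c u → CornerNeighbour n i ⟦ u ⟧
  neighbour {u} c~u = cornerNeighbour-of ⟦ c ⟧ ⟦ u ⟧ ∑⟦ c ⟧ cᵢ≡n ∑⟦ u ⟧ (asᶠ {c} {u} c~u)
  X = neighbour {x} c~x
  Y₁ = neighbour {y₁} c~y₁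
  Y₂ = neighbour {y₂} c~y₂
  Y₃ = neighbour {y₃} c~y₃
  adjacent : ∀ {a b : Vertex m n} (A : CornerNeighbour n i ⟦ a ⟧) (B : CornerNeighbour n i ⟦ b ⟧) →
             a ≢ b → Shares A B → Adj a b
  adjacent {a} {b} A B a≢b s = Adjᶠ⇒Adj {u = a} {v = b} (shares⇒adj A B (a≢b ∘ vertex-ext) s)
  conclude : Shares Y₁ Y₂ ⊎ Shares Y₁ Y₃ ⊎ Shares Y₂ Y₃ → ⊥
  conclude (inj₁ s) = y₁≁y₂ (adjacent {y₁} {y₂} Y₁ Y₂ y₁≢y₂ s)
  conclude (inj₂ (inj₁ s)) = y₁≁y₃ (adjacent {y₁} {y₃} Y₁ Y₃ y₁≢y₃ s)
  conclude (inj₂ (inj₂ s)) = y₂≁y₃ (adjacent {y₂} {y₃} Y₂ Y₃ y₂≢y₃ s)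

∘-aut : ∀ {m n} {f g : Vertex m n → Vertex m n} → IsAut f → IsAut g → IsAut (f ∘ g)
∘-aut {f = f} {g} F G = record
  { bijective = (λ e → proj₁ (IsAut.bijective G) (proj₁ (IsAut.bijective F) e))
              , λ y → let (x₁ , p₁) = proj₂ (IsAut.bijective F) y
                          (x₂ , p₂) = proj₂ (IsAut.bijective G) x₁
                      in x₂ , λ { refl → trans (cong f (p₂ refl)) (p₁ refl) }
  ; preservesAdj = λ u v → mk⇔
      (Equivalence.to (IsAut.preservesAdj F (g u) (g v)) ∘ Equivalence.to (IsAut.preservesAdj G u v))
      (Equivalence.from (IsAut.preservesAdj G u v) ∘ Equivalence.from (IsAut.preservesAdj F (g u) (g v))) }

aut-from-inverse : ∀ {m n} {f : Vertex m n → Vertex m n} (g : Vertex m n → Vertex m n) →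
  (∀ v → g (f v) ≡ v) → (∀ v → f (g v) ≡ v) → (∀ u v → Adj u v → Adj (f u) (f v)) → (∀ u v → Adj u v → Adj (g u) (g v)) → IsAut f
aut-from-inverse {f = f} g gf fg f-adj g-adj = record
  { bijective = (λ {x} {y} e → trans (sym (gf x)) (trans (cong g e) (gf y))) , (λ y → g y , λ { refl → fg y })
  ; preservesAdj = λ u v → mk⇔ (f-adj u v) (λ a → subst₂ Adj (gf u) (gf v) (g-adj (f u) (f v) a)) }

module Automorphism {m n} {f : Vertex m n → Vertex m n} (F : IsAut f) where
  adj : ∀ {u v} → Adj u v → Adj (f u) (f v)
  adj {u} {v} = Equivalence.to (IsAut.preservesAdj F u v)

  nonadj : ∀ {u v} → ¬ Adj u v → ¬ Adj (f u) (f v)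
  nonadj {u} {v} na = na ∘ Equivalence.from (IsAut.preservesAdj F u v)

  injective : ∀ {u v} → f u ≡ f v → u ≡ v
  injective = proj₁ (IsAut.bijective F)

  f⁻¹ : Vertex m n → Vertex m n
  f⁻¹ y = proj₁ (proj₂ (IsAut.bijective F) y)

  f∘f⁻¹ : ∀ y → f (f⁻¹ y) ≡ y
  f∘f⁻¹ y = proj₂ (proj₂ (IsAut.bijective F) y) refl

  f⁻¹∘f : ∀ x → f⁻¹ (f x) ≡ x
  f⁻¹∘f x = injective (f∘f⁻¹ (f x))

  inverse : IsAut f⁻¹
  inverse = aut-from-inverse f f∘f⁻¹ f⁻¹∘f
    (λ u v a → Equivalence.from (IsAut.preservesAdj F (f⁻¹ u) (f⁻¹ v)) (subst₂ Adj (sym (f∘f⁻¹ u)) (sym (f∘f⁻¹ v)) a))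
    (λ u v a → adj a)

  claw-image : ∀ {v} → Claw v → Claw (f v)
  claw-image (claw x y₁ y₂ y₃ v~x v~y₁ v~y₂ v~y₃ x~y₁ x~y₂ x~y₃ y₁≁y₂ y₁≁y₃ y₂≁y₃ y₁≢y₂ y₁≢y₃ y₂≢y₃) =
    claw (f x) (f y₁) (f y₂) (f y₃) (adj v~x) (adj v~y₁) (adj v~y₂) (adj v~y₃) (adj x~y₁) (adj x~y₂) (adj x~y₃)
      (nonadj y₁≁y₂) (nonadj y₁≁y₃) (nonadj y₂≁y₃) (y₁≢y₂ ∘ injective) (y₁≢y₃ ∘ injective) (y₂≢y₃ ∘ injective)

permuteV : ∀ {m n} → Permutation′ m → Vertex m n → Vertex m n
permuteV σ v = mkV (λ p → ⟦ v ⟧ (σ ⟨$⟩ʳ p)) (trans (∑-permute σ ⟦ v ⟧) ∑⟦ v ⟧)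

permuteV-at : ∀ {m n} (σ : Permutation′ m) (v : Vertex m n) p → ⟦ permuteV σ v ⟧ p ≡ ⟦ v ⟧ (σ ⟨$⟩ʳ p)
permuteV-at σ v p = lookup∘tabulate (λ q → ⟦ v ⟧ (σ ⟨$⟩ʳ q)) p

permuteV-realizes : ∀ {m n} (σ : Permutation′ m) → Realizes {m} {n} (permuteV σ) (permuteVec σ)
permuteV-realizes σ v = refl

lookup-permuteVec : ∀ {m} (σ : Permutation′ m) (u : Vec ℕ m) p → lookup (permuteVec σ u) p ≡ lookup u (σ ⟨$⟩ʳ p)
lookup-permuteVec σ u p = lookup∘tabulate (λ q → lookup u (σ ⟨$⟩ʳ q)) p

permuteV-inverse : ∀ {m n} (σ : Permutation′ m) (v : Vertex m n) → permuteV (flip σ) (permuteV σ v) ≡ v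
permuteV-inverse σ v = vertex-ext λ p →
  trans (permuteV-at (flip σ) (permuteV σ v) p) (trans (permuteV-at σ v _) (cong ⟦ v ⟧ (inverseʳ σ)))

permuteV-adj : ∀ {m n} (σ : Permutation′ m) (u v : Vertex m n) → Adj u v → Adj (permuteV σ u) (permuteV σ v)
permuteV-adj σ u v a = Adjᶠ⇒Adj {u = permuteV σ u} {v = permuteV σ v}
  (trans (∑-cong (λ p → cong₂ δ (permuteV-at σ u p) (permuteV-at σ v p)))
         (trans (∑-permute σ (Δ ⟦ u ⟧ ⟦ v ⟧)) (Adj⇒Adjᶠ {u = u} {v = v} a)))

permuteV-aut : ∀ {m n} (σ : Permutation′ m) → IsAut {m} {n} (permuteV σ)
permuteV-aut σ = aut-from-inverse (permuteV (flip σ)) (permuteV-inverse σ) (permuteV-inverse (flip σ))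
  (permuteV-adj σ) (permuteV-adj (flip σ))

module _ {m n} (n>2 : 2 < n) (third : ThirdPosition m) where

  claw-free⇒corner : (v : Vertex m n) → ¬ Claw v → IsCorner v
  claw-free⇒corner v no-claw with isCorner? v
  ... | yes c = c
  ... | no not-corner = ⊥-elim (no-claw (nonCorner-claw n>2 third v (λ i e → not-corner (i , e))))

  corner-image : ∀ {f : Vertex m n → Vertex m n} → IsAut f → ∀ v → IsCorner v → IsCorner (f v)
  corner-image {f} F v (i , vᵢ≡n) = claw-free⇒corner (f v) λ cl →
    corner-no-claw v vᵢ≡n (subst Claw (f⁻¹∘f v) (Automorphism.claw-image inverse cl))
    where open Automorphism F

  record Normalised (f : Vertex m n → Vertex m n) : Set where
    field
      σ : Permutation′ m
      g : Vertex m n → Vertex m n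
      g-aut : IsAut g
      g-fixes-corners : ∀ i → g (corner i) ≡ corner i
      f≡σ∘g : ∀ v → f v ≡ permuteV σ (g v)

  -- (abstract: only the fields of the result are used, and unfolding it is costly)
  abstract
    normalise : ∀ {f} → IsAut f → Normalised f
    normalise {f} F = record
      { σ = flip ρ
      ; g = permuteV ρ ∘ f
      ; g-aut = ∘-aut (permuteV-aut ρ) F
      ; g-fixes-corners = λ i → ≡corner (permuteV ρ (f (corner i)))
          (trans (permuteV-at ρ (f (corner i)) i) (trans (cong (λ w → ⟦ w ⟧ (π i)) (f-corner i)) (corner-at (π i))))
      ; f≡σ∘g = λ v → sym (permuteV-inverse ρ (f v))
      }
      where
      open Automorphism F
      n≢0 : n ≢ 0
      n≢0 = m<n⇒n≢0 n>2
      image : ∀ {h : Vertex m n → Vertex m n} → IsAut h → Fin m → Fin m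
      image H i = proj₁ (corner-image H (corner i) (i , corner-at i))
      π π⁻¹ : Fin m → Fin m
      π = image F
      π⁻¹ = image inverse
      image-corner : ∀ {h} (H : IsAut h) i → h (corner i) ≡ corner (image H i)
      image-corner H i = ≡corner _ (proj₂ (corner-image H (corner i) (i , corner-at i)))
      f-corner : ∀ i → f (corner i) ≡ corner (π i)
      f-corner = image-corner F
      corner-injective : ∀ {a b} → corner {m} {n} a ≡ corner b → a ≡ b
      corner-injective {a} {b} e = corner-unique n≢0 (corner b) (trans (cong (λ w → ⟦ w ⟧ a) (sym e)) (corner-at a)) (corner-at b)
      π∘π⁻¹ : ∀ j → π (π⁻¹ j) ≡ j
      π∘π⁻¹ j = corner-injective (trans (sym (f-corner (π⁻¹ j))) (trans (cong f (sym (image-corner inverse j))) (f∘f⁻¹ (corner j))))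
      π⁻¹∘π : ∀ i → π⁻¹ (π i) ≡ i
      π⁻¹∘π i = corner-injective (trans (sym (image-corner inverse (π i))) (trans (cong f⁻¹ (sym (f-corner i))) (f⁻¹∘f (corner i))))
      ρ : Permutation′ m
      ρ = permutation π π⁻¹ π∘π⁻¹ π⁻¹∘π

Within : ∀ {m n} → Vertex m n → Vertex m n → ℕ → Set
Within c v zero = v ≡ c
Within {m} {n} c v (suc k) = Within c v k ⊎ Σ (Vertex m n) (λ w → Adj v w × Within c w k)

within-image : ∀ {m n} {f : Vertex m n → Vertex m n} → IsAut f → ∀ {c} v k → Within c v k → Within (f c) (f v) k
within-image F v zero refl = refl
within-image F v (suc k) (inj₁ d) = inj₁ (within-image F v k d)
within-image {f = f} F v (suc k) (inj₂ (w , v~w , d)) = inj₂ (f w , Automorphism.adj F v~w , within-image F w k d)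

-- support h l is 1 if h l ≢ 0 and 0 otherwise; others i h counts the nonzero
-- positions of h other than i.  The distance from the corner n·eᵢ is others i.
support : ∀ {m} → (Fin m → ℕ) → Fin m → ℕ
support h l = δ (h l) 0

others : ∀ {m} → Fin m → (Fin m → ℕ) → ℕ
others i h = ∑ (support h [ i ]≔ 0)

support-split : ∀ {m} (h : Fin m → ℕ) i → ∑ (support h) ≡ support h i + others i h
support-split h i = ∑-split i (support h)

others-corner : ∀ {m n} (i : Fin m) → others i ⟦ corner {n = n} i ⟧ ≡ 0
others-corner {n = n} i = ∑-zero λ r → fin-cases r i (λ { refl → ≔-same _ r 0 })
  λ r≢i → trans (≔-other _ 0 r≢i) (cong (λ x → δ x 0) (corner-off r≢i))

others-step : ∀ {m} (i : Fin m) (h w : Fin m → ℕ) → Adjᶠ h w → ∑ h ≡ ∑ w → others i h ≤ suc (others i w)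
others-step i h w a ∑h≡∑w with Adjᶠ⇒Differ₂ a
... | differ₂ p q p≢q at-p at-q elsewhere = ∑-agree₂-≤ X Y p≢q agree bound
  where
  X = support h [ i ]≔ 0
  Y = support w [ i ]≔ 0
  X≤1 : ∀ r → X r ≤ 1
  X≤1 r = fin-cases r i (λ { refl → subst (_≤ 1) (sym (≔-same _ r 0)) z≤n })
            λ r≢i → subst (_≤ 1) (sym (≔-other _ 0 r≢i)) (δ≤1 (h r) 0)
  agree : ∀ r → r ≢ p → r ≢ q → X r ≡ Y r
  agree r r≢p r≢q = ≔-agree i 0 r λ _ → cong (λ x → δ x 0) (elsewhere r r≢p r≢q)
  -- if w vanishes at p and q, then so does h (equal sums), unless one of them is i
  bound : X p + X q ≤ suc (Y p + Y q)
  bound with Y p + Y q in e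
  ... | suc s = ≤-trans (+-mono-≤ (X≤1 p) (X≤1 q)) (s≤s (s≤s z≤n))
  ... | zero = fin-cases p i (λ { refl → subst (λ x → x + X q ≤ 1) (sym (≔-same _ p 0)) (X≤1 q) }) λ p≢i →
               fin-cases q i (λ { refl → subst (λ x → X p + x ≤ 1) (sym (≔-same _ q 0)) (subst (_≤ 1) (sym (+-identityʳ _)) (X≤1 p)) }) λ q≢i →
               ⊥-elim (at-p (trans (hₚ≡0 p≢i q≢i) (sym (wₚ≡0 p≢i))))
    where
    w-zero : ∀ {r} → r ≢ i → Y r ≡ 0 → w r ≡ 0
    w-zero r≢i Yr≡0 = δ≡0⇒≡ (trans (sym (≔-other _ 0 r≢i)) Yr≡0)
    wₚ≡0 : p ≢ i → w p ≡ 0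
    wₚ≡0 p≢i = w-zero p≢i (m+n≡0⇒m≡0 (Y p) e)
    hₚ≡0 : p ≢ i → q ≢ i → h p ≡ 0
    hₚ≡0 p≢i q≢i = m+n≡0⇒m≡0 (h p) (trans (∑-agree₂⁻ h w p≢q elsewhere ∑h≡∑w)
                     (cong₂ _+_ (wₚ≡0 p≢i) (w-zero q≢i (m+n≡0⇒n≡0 (Y p) e))))

within⇒others : ∀ {m n} (i : Fin m) (v : Vertex m n) k → Within (corner i) v k → others i ⟦ v ⟧ ≤ k
within⇒others i v zero refl = ≤-reflexive (others-corner i)
within⇒others i v (suc k) (inj₁ d) = m≤n⇒m≤1+n (within⇒others i v k d)
within⇒others i v (suc k) (inj₂ (w , v~w , d)) =
  ≤-trans (others-step i ⟦ v ⟧ ⟦ w ⟧ (Adj⇒Adjᶠ {u = v} {v = w} v~w) (trans ∑⟦ v ⟧ (sym ∑⟦ w ⟧))) (s≤s (within⇒others i w k d))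

-- Moving the whole value at position l ≢ i onto position i: a neighbour of v
-- one step closer to the corner n·eᵢ.
module Move {m n} (v : Vertex m n) {l i : Fin m} (l≢i : l ≢ i) where
  private
    h = ⟦ v ⟧
    movedᶠ = h [ l ]≔ 0 [ i ]≔ h i + h l

    moved-l : movedᶠ l ≡ 0
    moved-l = trans (≔-other _ _ l≢i) (≔-same h l 0)

    moved-i : movedᶠ i ≡ h i + h l
    moved-i = ≔-same _ i _

    moved-other : ∀ r → r ≢ l → r ≢ i → movedᶠ r ≡ h r
    moved-other r r≢l r≢i = trans (≔-other _ _ r≢i) (≔-other h 0 r≢l)

    ∑moved : ∑ movedᶠ ≡ n
    ∑moved = trans (∑-agree₂ movedᶠ h l≢i moved-other (trans (cong₂ _+_ moved-l moved-i) (+-comm (h i) (h l)))) ∑⟦ v ⟧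

  moved : Vertex m n
  moved = mkV movedᶠ ∑moved

  private
    at : ∀ r → ⟦ moved ⟧ r ≡ movedᶠ r
    at = mkV-at movedᶠ ∑moved

  moved-adj : h l ≢ 0 → Adj v moved
  moved-adj hₗ≢0 = Adjᶠ⇒Adj {u = v} {v = moved} (Differ₂⇒Adjᶠ (differ₂ l i l≢i
    (λ e → hₗ≢0 (trans e (trans (at l) moved-l)))
    (λ e → hₗ≢0 (sym (+-cancelˡ-≡ (h i) 0 (h l) (trans (+-identityʳ (h i)) (trans e (trans (at i) moved-i))))))
    (λ r r≢l r≢i → sym (trans (at r) (moved-other r r≢l r≢i)))))

  moved-others : h l ≢ 0 → others i h ≡ suc (others i ⟦ moved ⟧)
  moved-others hₗ≢0 = begin
    ∑ X                ≡⟨ ∑-split l X ⟩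
    X l + ∑ (X [ l ]≔ 0) ≡⟨ cong₂ _+_ Xₗ≡1 (∑-cong same) ⟩
    suc (others i ⟦ moved ⟧) ∎
    where
    open ≡-Reasoning
    X = support h [ i ]≔ 0
    Xₗ≡1 : X l ≡ 1
    Xₗ≡1 = trans (≔-other _ 0 l≢i) (δ-≢ hₗ≢0)
    same : ∀ r → (X [ l ]≔ 0) r ≡ (support ⟦ moved ⟧ [ i ]≔ 0) r
    same r = fin-cases r l
      (λ { refl → trans (≔-same X r 0) (sym (trans (≔-other _ 0 l≢i) (cong (λ x → δ x 0) (trans (at r) moved-l)))) })
      λ r≢l → trans (≔-other X 0 r≢l) (≔-agree i 0 r λ r≢i → cong (λ x → δ x 0) (sym (trans (at r) (moved-other r r≢l r≢i))))

-- Conversely, with at most k other nonzero positions v is within distance k of n·eᵢ: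
-- moving one of them onto i is one step towards the corner.
others⇒within : ∀ {m n} (i : Fin m) (v : Vertex m n) k → others i ⟦ v ⟧ ≤ k → Within (corner i) v k
others⇒within {n = n} i v zero others≤0 = ≡corner v (trans (sym (∑-point i ⟦ v ⟧ off-i)) ∑⟦ v ⟧)
  where
  off-i : ∀ r → r ≢ i → ⟦ v ⟧ r ≡ 0
  off-i r r≢i = δ≡0⇒≡ (trans (sym (≔-other _ 0 r≢i)) (∑≡0⇒coord≡0 _ (n≤0⇒n≡0 others≤0) r))
others⇒within i v (suc k) others≤k+1 with others i ⟦ v ⟧ ≤? k
... | yes others≤k = inj₁ (others⇒within i v k others≤k)
... | no others≰k = step (∑-nonzero (support ⟦ v ⟧ [ i ]≔ 0) (λ e → others≰k (subst (_≤ k) (sym e) z≤n)))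
  where
  step : (∃ λ l → (support ⟦ v ⟧ [ i ]≔ 0) l ≢ 0) → Within (corner i) v (suc k)
  step (l , nonzero) = fin-cases l i (λ { refl → ⊥-elim (nonzero (≔-same _ l 0)) }) λ l≢i →
    let vₗ≢0 : ⟦ v ⟧ l ≢ 0
        vₗ≢0 e = nonzero (trans (≔-other _ 0 l≢i) (cong (λ x → δ x 0) e))
        open Move v l≢i
    in inj₂ (moved , moved-adj vₗ≢0 , others⇒within i moved k (≤-pred (subst (_≤ suc k) (moved-others vₗ≢0) others≤k+1)))

Closest : ∀ {m n} → Fin m → Vertex m n → Set
Closest {m} {n} i v = ∀ j k → Within (corner {m} {n} j) v k → Within (corner i) v k

nonzero⇒closest : ∀ {m n} (v : Vertex m n) {i : Fin m} → ⟦ v ⟧ i ≢ 0 → Closest i v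
nonzero⇒closest v {i} vᵢ≢0 j k d = others⇒within i v k (≤-trans others-i≤others-j (within⇒others j v k d))
  where
  h = ⟦ v ⟧
  others-i≤others-j : others i h ≤ others j h
  others-i≤others-j = ≤-pred (subst (_≤ suc (others j h))
    (trans (sym (support-split h j)) (trans (support-split h i) (cong (_+ others i h) (δ-≢ vᵢ≢0))))
    (+-monoˡ-≤ (others j h) (δ≤1 (h j) 0)))

-- A position outside the support is farther from v than any position in the support.
closest⇒nonzero : ∀ {m n} → n ≢ 0 → (v : Vertex m n) {i : Fin m} → Closest i v → ⟦ v ⟧ i ≢ 0
closest⇒nonzero n≢0 v {i} closest vᵢ≡0 with ∑-nonzero ⟦ v ⟧ (n≢0 ∘ trans (sym ∑⟦ v ⟧))
... | j , vⱼ≢0 = <-irrefl refl (≤-trans others-j<others-i (within⇒others i v _ (closest j _ (others⇒within j v _ ≤-refl))))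
  where
  h = ⟦ v ⟧
  others-j<others-i : others j h < others i h
  others-j<others-i = ≤-reflexive (trans (sym (trans (support-split h j) (cong (_+ others j h) (δ-≢ vⱼ≢0))))
                        (trans (support-split h i) (cong (λ x → δ x 0 + others i h) vᵢ≡0)))

module CornerFixing {m n} (n≢0 : n ≢ 0) {g : Vertex m n → Vertex m n} (G : IsAut g) (fixes : ∀ i → g (corner i) ≡ corner {m} {n} i) where
  open Automorphism G

  inverse-fixes : ∀ i → f⁻¹ (corner i) ≡ corner {m} {n} i
  inverse-fixes i = trans (cong f⁻¹ (sym (fixes i))) (f⁻¹∘f (corner i))

  private
    closest-image : ∀ {h} (H : IsAut h) (fixes-h : ∀ i → h (corner i) ≡ corner {m} {n} i)
                      {h⁻¹} (H⁻¹ : IsAut h⁻¹) (fixes-h⁻¹ : ∀ i → h⁻¹ (corner i) ≡ corner {m} {n} i) (back : ∀ x → h⁻¹ (h x) ≡ x) →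
                      ∀ v {i} → Closest i v → Closest i (h v)
    closest-image {h} H fixes-h {h⁻¹} H⁻¹ fixes-h⁻¹ back v {i} closest j k d =
      subst (λ c → Within c (h v) k) (fixes-h i)
        (within-image H {corner i} v k (closest j k
          (subst₂ (λ c x → Within c x k) (fixes-h⁻¹ j) (back v) (within-image H⁻¹ {corner j} (h v) k d))))

  support-image : ∀ v {i} → ⟦ v ⟧ i ≢ 0 → ⟦ g v ⟧ i ≢ 0
  support-image v {i} vᵢ≢0 = closest⇒nonzero n≢0 (g v) {i}
    (closest-image G fixes inverse inverse-fixes f⁻¹∘f v {i} (nonzero⇒closest v {i} vᵢ≢0))

  zero-image : ∀ v {i} → ⟦ v ⟧ i ≡ 0 → ⟦ g v ⟧ i ≡ 0
  zero-image v {i} vᵢ≡0 with ⟦ g v ⟧ i ≟ 0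
  ... | yes e = e
  ... | no ne = ⊥-elim (closest⇒nonzero n≢0 v
          {i} (subst (Closest i) (f⁻¹∘f v) (closest-image inverse inverse-fixes G fixes f∘f⁻¹ (g v) {i} (nonzero⇒closest (g v) {i} ne))) vᵢ≡0)

swap12-involutive : ∀ x → swap12 (swap12 x) ≡ x
swap12-involutive 0 = refl
swap12-involutive 1 = refl
swap12-involutive 2 = refl
swap12-involutive (suc (suc (suc x))) = refl

swap12-injective : ∀ {x y} → swap12 x ≡ swap12 y → x ≡ y
swap12-injective {x} {y} e = trans (sym (swap12-involutive x)) (trans (cong swap12 e) (swap12-involutive y))

δ-swap12 : ∀ a b → δ (swap12 a) (swap12 b) ≡ δ a b
δ-swap12 a b with a ≟ b
... | yes refl = trans (δ-≡ (swap12 a)) (sym (δ-≡ a))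
... | no a≢b = trans (δ-≢ (a≢b ∘ swap12-injective)) (sym (δ-≢ a≢b))

private
  hasTwo-true : ∀ {m} (u : Vec ℕ m) i → lookup u i ≡ 2 → hasTwo u ≡ true
  hasTwo-true (a ∷ u) zero refl = refl
  hasTwo-true (a ∷ u) (suc i) e with a ≡ᵇ 2
  ... | true = refl
  ... | false = hasTwo-true u i e

  hasTwo-false : ∀ {m} (u : Vec ℕ m) → (∀ i → lookup u i ≢ 2) → hasTwo u ≡ false
  hasTwo-false [] _ = refl
  hasTwo-false (a ∷ u) no-two with a ≡ᵇ 2 in e
  ... | true = ⊥-elim (no-two zero (≡ᵇ⇒≡ a 2 (subst T (sym e) _)))
  ... | false = hasTwo-false u (no-two ∘ suc)

tauVec-two : ∀ {m} (u : Vec ℕ m) {i} → lookup u i ≡ 2 → tauVec u ≡ map swap12 u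
tauVec-two u {i} uᵢ≡2 rewrite hasTwo-true u i uᵢ≡2 = refl

tauVec-no-two : ∀ {m} (u : Vec ℕ m) → (∀ i → lookup u i ≢ 2) → tauVec u ≡ u
tauVec-no-two u no-two rewrite hasTwo-false u no-two = refl

record TwoOne {m} (h : Fin m → ℕ) (i : Fin m) : Set where
  constructor twoOne
  field
    j : Fin m
    j≢i : j ≢ i
    at-j : h j ≡ 1
    elsewhere : ∀ l → l ≢ i → l ≢ j → h l ≡ 0

two-one : ∀ {m} (h : Fin m → ℕ) → ∑ h ≡ 3 → ∀ {i} → h i ≡ 2 → TwoOne h i
two-one h ∑h≡3 {i} hᵢ≡2 = find (∑-nonzero (h [ i ]≔ 0) (λ e → 1≢0 (trans (sym rest≡1) e)))
  where
  1≢0 : 1 ≢ 0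
  1≢0 ()
  rest≡1 : ∑ (h [ i ]≔ 0) ≡ 1
  rest≡1 = +-cancelˡ-≡ 2 (∑ (h [ i ]≔ 0)) 1 (trans (cong (_+ ∑ (h [ i ]≔ 0)) (sym hᵢ≡2)) (trans (sym (∑-split i h)) ∑h≡3))
  find : (∃ λ j → (h [ i ]≔ 0) j ≢ 0) → TwoOne h i
  find (j , rest-j≢0) = fin-cases j i (λ { refl → ⊥-elim (rest-j≢0 (≔-same h j 0)) }) λ j≢i →
    let rest-j≡hⱼ = ≔-other h 0 j≢i
        split = trans (sym (∑-split j (h [ i ]≔ 0))) rest≡1
        hⱼ≡1 : h j ≡ 1
        hⱼ≡1 = trans (sym rest-j≡hⱼ) (positive-summand (rest-j≢0) split)
        rest₂≡0 = +-cancelˡ-≡ 1 (∑ (h [ i ]≔ 0 [ j ]≔ 0)) 0 (trans (cong (_+ ∑ (h [ i ]≔ 0 [ j ]≔ 0)) (sym (trans rest-j≡hⱼ hⱼ≡1))) split)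
    in twoOne j j≢i hⱼ≡1 λ l l≢i l≢j →
         trans (sym (trans (≔-other (h [ i ]≔ 0) 0 l≢j) (≔-other h 0 l≢i))) (∑≡0⇒coord≡0 (h [ i ]≔ 0 [ j ]≔ 0) rest₂≡0 l)
    where
    positive-summand : ∀ {x y} → x ≢ 0 → x + y ≡ 1 → x ≡ 1
    positive-summand {zero} x≢0 _ = ⊥-elim (x≢0 refl)
    positive-summand {suc zero} _ _ = refl
    positive-summand {suc (suc x)} _ ()

HasTwo : ∀ {m n} → Vertex m n → Set
HasTwo v = ∃ λ i → ⟦ v ⟧ i ≡ 2

hasTwo? : ∀ {m n} (v : Vertex m n) → Dec (HasTwo v)
hasTwo? v = any? (λ i → ⟦ v ⟧ i ≟ 2)

-- τ keeps the coordinate sum 3 (abstract, so that equations between τ-images never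
-- unfold this proof).
abstract
  tau-sum : ∀ {m} (u : Vec ℕ m) → sum u ≡ 3 → sum (tauVec u) ≡ 3
  tau-sum u sum≡3 with any? (λ i → lookup u i ≟ 2)
  ... | no no-two = trans (cong sum (tauVec-no-two u (λ i e → no-two (i , e)))) sum≡3
  ... | yes (i , uᵢ≡2) with two-one (lookup u) (trans (sym (sum≡∑ u)) sum≡3) uᵢ≡2
  ... | twoOne j j≢i uⱼ≡1 elsewhere = begin
    sum (tauVec u)                  ≡⟨ cong sum (tauVec-two u uᵢ≡2) ⟩
    sum (map swap12 u)              ≡⟨ sum≡∑ (map swap12 u) ⟩
    ∑ (lookup (map swap12 u))       ≡⟨ ∑-cong (λ r → lookup-map r swap12 u) ⟩
    ∑ (swap12 ∘ lookup u)           ≡⟨ ∑-two (swap12 ∘ lookup u) (j≢i ∘ sym) (λ l l≢i l≢j → cong swap12 (elsewhere l l≢i l≢j)) ⟩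
    swap12 (lookup u i) + swap12 (lookup u j) ≡⟨ cong₂ (λ x y → swap12 x + swap12 y) uᵢ≡2 uⱼ≡1 ⟩
    3                               ∎
    where open ≡-Reasoning

τ : ∀ {m} → Vertex m 3 → Vertex m 3
τ (u , sum≡3) = tauVec u , tau-sum u sum≡3

τ-realizes : ∀ {m} → Realizes {m} {3} τ tauVec
τ-realizes v = refl

τ-two : ∀ {m} (v : Vertex m 3) {i} → ⟦ v ⟧ i ≡ 2 → ∀ r → ⟦ τ v ⟧ r ≡ swap12 (⟦ v ⟧ r)
τ-two (u , _) vᵢ≡2 r = trans (cong (λ w → lookup w r) (tauVec-two u vᵢ≡2)) (lookup-map r swap12 u)

τ-no-two : ∀ {m} (v : Vertex m 3) → ¬ HasTwo v → ∀ r → ⟦ τ v ⟧ r ≡ ⟦ v ⟧ r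
τ-no-two (u , _) no-two r = cong (λ w → lookup w r) (tauVec-no-two u (λ i e → no-two (i , e)))

τ-involutive : ∀ {m} (v : Vertex m 3) → τ (τ v) ≡ v
τ-involutive v with hasTwo? v
... | no no-two = vertex-ext λ r → trans (τ-no-two (τ v) τv-no-two r) (τ-no-two v no-two r)
  where
  τv-no-two : ¬ HasTwo (τ v)
  τv-no-two (i , e) = no-two (i , trans (sym (τ-no-two v no-two i)) e)
... | yes (i , vᵢ≡2) with two-one ⟦ v ⟧ ∑⟦ v ⟧ vᵢ≡2
... | twoOne j _ vⱼ≡1 _ = vertex-ext λ r →
  trans (τ-two (τ v) {j} (trans (τ-two v vᵢ≡2 j) (cong swap12 vⱼ≡1)) r)
        (trans (cong swap12 (τ-two v vᵢ≡2 r)) (swap12-involutive _))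

swap-adj-mixed : ∀ {m} (h k : Fin m → ℕ) → ∑ h ≡ 3 → ∑ k ≡ 3 → ∀ {i} → h i ≡ 2 → (∀ l → k l ≢ 2) →
                 Adjᶠ h k → Adjᶠ (swap12 ∘ h) k
swap-adj-mixed h k ∑h ∑k {i} hᵢ≡2 k≢2 a with two-one h ∑h hᵢ≡2 | Adjᶠ⇒Differ₂ a
... | twoOne j j≢i hⱼ≡1 h-elsewhere | differ₂ p q p≢q at-p at-q elsewhere =
  fin-cases p i (λ { refl → at-i-and q (p≢q ∘ sym) (λ l l≢i l≢q → elsewhere l l≢i l≢q) at-q }) λ p≢i →
  fin-cases q i (λ { refl → at-i-and p p≢i (λ l l≢i l≢p → elsewhere l l≢p l≢i) at-p }) λ q≢i →
  ⊥-elim (k≢2 i (trans (sym (elsewhere i (p≢i ∘ sym) (q≢i ∘ sym))) hᵢ≡2))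
  where
  at-i-and : ∀ r → r ≢ i → (∀ l → l ≢ i → l ≢ r → h l ≡ k l) → h r ≢ k r → Adjᶠ (swap12 ∘ h) k
  at-i-and r r≢i agree at-r = fin-cases r j r-is-j r-is-new
    where
    sums : h i + h r ≡ k i + k r
    sums = ∑-agree₂⁻ h k (r≢i ∘ sym) agree (trans ∑h (sym ∑k))
    -- r = j: swapping turns h into eᵢ + 2e_j, which differs from k exactly at i and j
    r-is-j : r ≡ j → Adjᶠ (swap12 ∘ h) k
    r-is-j refl = Differ₂⇒Adjᶠ (differ₂ i r (r≢i ∘ sym)
      (λ e → kᵣ≢2 (+-cancelˡ-≡ 1 (k r) 2 (trans (sym (cong (_+ k r) (trans (sym e) (cong swap12 hᵢ≡2)))) (trans (sym sums) (cong₂ _+_ hᵢ≡2 hⱼ≡1)))))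
      (λ e → kᵣ≢2 (trans (sym e) (cong swap12 hⱼ≡1)))
      (λ l l≢i l≢r → trans (cong swap12 (h-elsewhere l l≢i l≢r)) (trans (sym (h-elsewhere l l≢i l≢r)) (agree l l≢i l≢r))))
      where
      kᵣ≢2 : k r ≢ 2
      kᵣ≢2 = k≢2 r
    -- r ≠ j: then k = eᵢ + e_j + e_r, while swapping turns h into eᵢ + 2e_j
    r-is-new : r ≢ j → Adjᶠ (swap12 ∘ h) k
    r-is-new r≢j = Differ₂⇒Adjᶠ (differ₂ j r (r≢j ∘ sym)
      (λ e → k≢2 j (trans (sym e) (cong swap12 hⱼ≡1)))
      (λ e → kᵣ≢0 (trans (sym e) (cong swap12 hᵣ≡0)))
      (λ l l≢j l≢r → fin-cases l i (λ { refl → trans (cong swap12 hᵢ≡2) (sym kᵢ≡1) })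
         λ l≢i → trans (cong swap12 (h-elsewhere l l≢i l≢j)) (trans (sym (h-elsewhere l l≢i l≢j)) (agree l l≢i l≢r))))
      where
      hᵣ≡0 : h r ≡ 0
      hᵣ≡0 = h-elsewhere r r≢i r≢j
      kᵣ≢0 : k r ≢ 0
      kᵣ≢0 e = at-r (trans hᵣ≡0 (sym e))
      kᵢ+kᵣ≡2 : k i + k r ≡ 2
      kᵢ+kᵣ≡2 = trans (sym sums) (cong₂ _+_ hᵢ≡2 hᵣ≡0)
      kᵢ≡1 : k i ≡ 1
      kᵢ≡1 = both-one (k i) (k r) kᵢ+kᵣ≡2 (k≢2 i) kᵣ≢0 (k≢2 r)
        where
        both-one : ∀ x y → x + y ≡ 2 → x ≢ 2 → y ≢ 0 → y ≢ 2 → x ≡ 1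
        both-one 0 y e _ _ y≢2 = ⊥-elim (y≢2 e)
        both-one 1 y _ _ _ _ = refl
        both-one 2 y _ x≢2 _ _ = ⊥-elim (x≢2 refl)
        both-one (suc (suc (suc x))) y () _ _ _

-- τ preserves adjacency: the only non-trivial case is a vertex with a 2 next to
-- one without, handled by swap-adj-mixed.
τ-adj : ∀ {m} (u w : Vertex m 3) → Adj u w → Adj (τ u) (τ w)
τ-adj u w a = Adjᶠ⇒Adj {u = τ u} {v = τ w} (by-cases (hasTwo? u) (hasTwo? w))
  where
  aᶠ : Adjᶠ ⟦ u ⟧ ⟦ w ⟧
  aᶠ = Adj⇒Adjᶠ {u = u} {v = w} a
  no-two : ∀ {v : Vertex _ 3} → ¬ HasTwo v → ∀ l → ⟦ v ⟧ l ≢ 2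
  no-two ¬two l e = ¬two (l , e)
  by-cases : Dec (HasTwo u) → Dec (HasTwo w) → Adjᶠ ⟦ τ u ⟧ ⟦ τ w ⟧
  by-cases (no ¬u) (no ¬w) = Adjᶠ-cong (sym ∘ τ-no-two u ¬u) (sym ∘ τ-no-two w ¬w) aᶠ
  by-cases (yes (i , uᵢ≡2)) (yes (j , wⱼ≡2)) =
    trans (∑-cong (λ r → trans (cong₂ δ (τ-two u uᵢ≡2 r) (τ-two w wⱼ≡2 r)) (δ-swap12 (⟦ u ⟧ r) (⟦ w ⟧ r)))) aᶠ
  by-cases (yes (i , uᵢ≡2)) (no ¬w) = Adjᶠ-cong (sym ∘ τ-two u uᵢ≡2) (sym ∘ τ-no-two w ¬w)
    (swap-adj-mixed ⟦ u ⟧ ⟦ w ⟧ ∑⟦ u ⟧ ∑⟦ w ⟧ uᵢ≡2 (no-two {w} ¬w) aᶠ)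
  by-cases (no ¬u) (yes (j , wⱼ≡2)) = Adjᶠ-cong (sym ∘ τ-no-two u ¬u) (sym ∘ τ-two w wⱼ≡2)
    (Adjᶠ-sym {h = swap12 ∘ ⟦ w ⟧} {k = ⟦ u ⟧} (swap-adj-mixed ⟦ w ⟧ ⟦ u ⟧ ∑⟦ w ⟧ ∑⟦ u ⟧ wⱼ≡2 (no-two {u} ¬u) (Adjᶠ-sym {h = ⟦ u ⟧} {k = ⟦ w ⟧} aᶠ)))

τ-aut : ∀ {m} → IsAut {m} {3} τ
τ-aut = aut-from-inverse τ τ-involutive τ-involutive τ-adj τ-adj

module _ {m} {a b : Fin m} (a≢b : a ≢ b) where
  private
    twoOneᶠ : Fin m → ℕ
    twoOneᶠ = (λ _ → 0) [ a ]≔ 2 [ b ]≔ 1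

  abstract
    ∑twoOneᶠ : ∑ twoOneᶠ ≡ 3
    ∑twoOneᶠ = trans (∑-two twoOneᶠ a≢b (λ r r≢a r≢b → trans (≔-other _ 1 r≢b) (≔-other _ 2 r≢a)))
                     (cong₂ _+_ (trans (≔-other _ 1 a≢b) (≔-same _ a 2)) (≔-same _ b 1))

  twoOneV : Vertex m 3
  twoOneV = mkV twoOneᶠ ∑twoOneᶠ

  twoOneV-a : ⟦ twoOneV ⟧ a ≡ 2
  twoOneV-a = trans (mkV-at twoOneᶠ ∑twoOneᶠ a) (trans (≔-other _ 1 a≢b) (≔-same _ a 2))

  twoOneV-b : ⟦ twoOneV ⟧ b ≡ 1
  twoOneV-b = trans (mkV-at twoOneᶠ ∑twoOneᶠ b) (≔-same _ b 1)

  twoOneV-off : ∀ r → r ≢ a → r ≢ b → ⟦ twoOneV ⟧ r ≡ 0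
  twoOneV-off r r≢a r≢b = trans (mkV-at twoOneᶠ ∑twoOneᶠ r) (trans (≔-other _ 1 r≢b) (≔-other _ 2 r≢a))

  ≡twoOneV : ∀ (v : Vertex m 3) → ⟦ v ⟧ a ≡ 2 → ⟦ v ⟧ b ≡ 1 → v ≡ twoOneV
  ≡twoOneV v vₐ≡2 v_b≡1 with two-one ⟦ v ⟧ ∑⟦ v ⟧ vₐ≡2
  ... | twoOne j j≢a vⱼ≡1 elsewhere = vertex-ext λ r →
    fin-cases r a (λ { refl → trans vₐ≡2 (sym twoOneV-a) }) λ r≢a →
    fin-cases r b (λ { refl → trans v_b≡1 (sym twoOneV-b) }) λ r≢b →
    trans (elsewhere r r≢a (λ { refl → r≢b j≡b })) (sym (twoOneV-off r r≢a r≢b))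
    where
    j≡b : j ≡ b
    j≡b = fin-cases j b (λ e → e) λ j≢b → ⊥-elim (1≢0 (trans (sym v_b≡1) (elsewhere b (a≢b ∘ sym) (j≢b ∘ sym))))
      where
      1≢0 : 1 ≢ 0
      1≢0 ()

τ-twoOneV : ∀ {m} {a b : Fin m} (a≢b : a ≢ b) → τ (twoOneV a≢b) ≡ twoOneV (a≢b ∘ sym)
τ-twoOneV {a = a} {b} a≢b = vertex-ext λ r →
  fin-cases r a (λ { refl → trans (τ-at r) (trans (cong swap12 (twoOneV-a a≢b)) (sym (twoOneV-b b≢a))) }) λ r≢a →
  fin-cases r b (λ { refl → trans (τ-at r) (trans (cong swap12 (twoOneV-b a≢b)) (sym (twoOneV-a b≢a))) }) λ r≢b →
  trans (τ-at r) (trans (cong swap12 (twoOneV-off a≢b r r≢a r≢b)) (sym (twoOneV-off b≢a r r≢b r≢a)))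
  where
  b≢a = a≢b ∘ sym
  τ-at : ∀ r → ⟦ τ (twoOneV a≢b) ⟧ r ≡ swap12 (⟦ twoOneV a≢b ⟧ r)
  τ-at = τ-two (twoOneV a≢b) (twoOneV-a a≢b)

pairs-connected : ∀ {m} (P : Fin m → Fin m → Set) →
  (∀ {a b c} → a ≢ b → a ≢ c → b ≢ c → P a b → P a c) → (∀ {a b} → a ≢ b → P a b → P b a) →
  ∀ {a₀ a₁} → a₀ ≢ a₁ → P a₀ a₁ → ∀ {i j} → i ≢ j → P i j
pairs-connected P change swap {a₀} {a₁} a₀≢a₁ p₀ {i} {j} i≢j =
  fin-cases i a₀ (λ { refl → from-a₀ j (i≢j ∘ sym) }) λ i≢a₀ →
  fin-cases j a₀ (λ { refl → swap (i≢j ∘ sym) (from-a₀ i i≢a₀) }) λ j≢a₀ →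
  change i≢a₀ i≢j (j≢a₀ ∘ sym) (swap (i≢a₀ ∘ sym) (from-a₀ i i≢a₀))
  where
  from-a₀ : ∀ x → x ≢ a₀ → P a₀ x
  from-a₀ x x≢a₀ = fin-cases x a₁ (λ { refl → p₀ }) λ x≢a₁ → change a₀≢a₁ (x≢a₀ ∘ sym) (x≢a₁ ∘ sym) p₀

every-vertex : ∀ {m} (P : Vertex m 3 → Set) → (∀ {i j : Fin m} (i≢j : i ≢ j) → P (twoOneV i≢j)) →
               (∀ v → ¬ HasTwo v → P v) → ∀ v → P v
every-vertex P two-one-case no-two-case v = by-cases (hasTwo? v)
  where
  by-cases : Dec (HasTwo v) → P v
  by-cases (no ¬two) = no-two-case v ¬two
  by-cases (yes (i , vᵢ≡2)) = by-shape (two-one ⟦ v ⟧ ∑⟦ v ⟧ vᵢ≡2)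
    where
    by-shape : TwoOne ⟦ v ⟧ i → P v
    by-shape (twoOne j j≢i vⱼ≡1 _) = subst P (sym (≡twoOneV (j≢i ∘ sym) v vᵢ≡2 vⱼ≡1)) (two-one-case (j≢i ∘ sym))

module CornerFixing3 {m} {g : Vertex m 3 → Vertex m 3} (G : IsAut g) (fixes : ∀ i → g (corner i) ≡ corner {m} {3} i) where
  open Automorphism G
  open CornerFixing (λ ()) G fixes

  -- Without a coordinate 2 the vertex is a corner or has all coordinates ≤ 1;
  -- the latter is determined by its support.
  fixes-no-two : ∀ v → ¬ HasTwo v → g v ≡ v
  fixes-no-two v ¬two with isCorner? v
  ... | yes (i , vᵢ≡3) = trans (cong g (≡corner v vᵢ≡3)) (trans (fixes i) (sym (≡corner v vᵢ≡3)))
  ... | no ¬corner = sym (vertex-ext (∑-≤-≡ ⟦ v ⟧ ⟦ g v ⟧ below (trans ∑⟦ v ⟧ (sym ∑⟦ g v ⟧))))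
    where
    small : ∀ x → x ≤ 3 → x ≢ 2 → x ≢ 3 → x ≤ 1
    small 0 _ _ _ = z≤n
    small 1 _ _ _ = s≤s z≤n
    small 2 _ x≢2 _ = ⊥-elim (x≢2 refl)
    small 3 _ _ x≢3 = ⊥-elim (x≢3 refl)
    small (suc (suc (suc (suc x)))) (s≤s (s≤s (s≤s ()))) _ _
    below : ∀ l → ⟦ v ⟧ l ≤ ⟦ g v ⟧ l
    below l with ⟦ v ⟧ l ≟ 0
    ... | yes vₗ≡0 = subst (_≤ ⟦ g v ⟧ l) (sym vₗ≡0) z≤n
    ... | no vₗ≢0 = ≤-trans (small (⟦ v ⟧ l) (subst (⟦ v ⟧ l ≤_) ∑⟦ v ⟧ (coord≤∑ ⟦ v ⟧ l)) (λ e → ¬two (l , e)) (λ e → ¬corner (l , e)))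
                              (n≢0⇒n>0 (support-image v vₗ≢0))

  -- 2·eᵢ + e_j keeps its support {i , j}, so it goes to itself or to eᵢ + 2·e_j.
  fixes-or-swaps : ∀ v {i} → ⟦ v ⟧ i ≡ 2 → g v ≡ v ⊎ g v ≡ τ v
  fixes-or-swaps v {i} vᵢ≡2 with two-one ⟦ v ⟧ ∑⟦ v ⟧ vᵢ≡2
  ... | twoOne j j≢i vⱼ≡1 elsewhere = by-value (⟦ g v ⟧ i) refl
    where
    i≢j = j≢i ∘ sym
    w = ⟦ g v ⟧
    w-sum : w i + w j ≡ 3
    w-sum = trans (sym (∑-two w i≢j (λ l l≢i l≢j → zero-image v (elsewhere l l≢i l≢j)))) ∑⟦ g v ⟧
    v≡ : v ≡ twoOneV i≢j
    v≡ = ≡twoOneV i≢j v vᵢ≡2 vⱼ≡1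
    wⱼ : ∀ x → w i ≡ x → x + w j ≡ 3
    wⱼ x e = trans (cong (_+ w j) (sym e)) w-sum
    by-value : ∀ x → w i ≡ x → g v ≡ v ⊎ g v ≡ τ v
    by-value 0 e = ⊥-elim (support-image v (λ vᵢ≡0 → 2≢0 (trans (sym vᵢ≡2) vᵢ≡0)) e)
      where
      2≢0 : 2 ≢ 0
      2≢0 ()
    by-value 1 e = inj₂ (trans (≡twoOneV (i≢j ∘ sym) (g v) (+-cancelˡ-≡ 1 (w j) 2 (wⱼ 1 e)) e)
                        (sym (trans (cong τ v≡) (τ-twoOneV i≢j))))
    by-value 2 e = inj₁ (trans (≡twoOneV i≢j (g v) e (+-cancelˡ-≡ 2 (w j) 1 (wⱼ 2 e))) (sym v≡))
    by-value (suc (suc (suc x))) e = ⊥-elim (support-image v (λ vⱼ≡0 → 1≢0 (trans (sym vⱼ≡1) vⱼ≡0))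
                                        (m+n≡0⇒n≡0 x (+-cancelˡ-≡ 3 (x + w j) 0 (wⱼ _ e))))
      where
      1≢0 : 1 ≢ 0
      1≢0 ()

  -- The behaviour on the vertices 2·e_a + e_b is the same for all pairs (a , b).
  Fixed Swapped : Fin m → Fin m → Set
  Fixed a b = (a≢b : a ≢ b) → g (twoOneV a≢b) ≡ twoOneV a≢b
  Swapped a b = (a≢b : a ≢ b) → g (twoOneV a≢b) ≡ τ (twoOneV a≢b)

  private
    twoOneV-irrelevant : ∀ {a b : Fin m} (p q : a ≢ b) → twoOneV p ≡ twoOneV q
    twoOneV-irrelevant p q = vertex-ext λ r → refl

    -- 2e_a + e_b ~ 2e_a + e_c; a mixed choice would make 2e_a + e_b adjacent to 2e_c + e_a
    -- (or 2e_b + e_a adjacent to 2e_a + e_c), which differ at a, b and c.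
    mixed-impossible : ∀ {a b c : Fin m} (a≢b : a ≢ b) (a≢c : a ≢ c) (b≢c : b ≢ c) →
                       ¬ Adj (twoOneV a≢b) (twoOneV (a≢c ∘ sym)) × ¬ Adj (twoOneV (a≢b ∘ sym)) (twoOneV a≢c)
    mixed-impossible a≢b a≢c b≢c =
      three-differences {x = twoOneV a≢b} {y = twoOneV (a≢c ∘ sym)} a≢b a≢c b≢c
        (λ e → 2≢1 (trans (sym (twoOneV-a a≢b)) (trans e (twoOneV-b (a≢c ∘ sym)))))
        (λ e → 1≢0 (trans (sym (twoOneV-b a≢b)) (trans e (twoOneV-off (a≢c ∘ sym) _ b≢c (a≢b ∘ sym)))))
        (λ e → 0≢2 (trans (sym (twoOneV-off a≢b _ (a≢c ∘ sym) (b≢c ∘ sym))) (trans e (twoOneV-a (a≢c ∘ sym)))))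
      , three-differences {x = twoOneV (a≢b ∘ sym)} {y = twoOneV a≢c} a≢b a≢c b≢c
        (λ e → 1≢2 (trans (sym (twoOneV-b (a≢b ∘ sym))) (trans e (twoOneV-a a≢c))))
        (λ e → 2≢0 (trans (sym (twoOneV-a (a≢b ∘ sym))) (trans e (twoOneV-off a≢c _ (a≢b ∘ sym) b≢c))))
        (λ e → 0≢1 (trans (sym (twoOneV-off (a≢b ∘ sym) _ (b≢c ∘ sym) (a≢c ∘ sym))) (trans e (twoOneV-b a≢c))))
      where
      2≢1 : 2 ≢ 1
      2≢1 ()
      1≢0 : 1 ≢ 0
      1≢0 ()
      0≢2 : 0 ≢ 2
      0≢2 ()
      1≢2 : 1 ≢ 2
      1≢2 ()
      2≢0 : 2 ≢ 0
      2≢0 ()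
      0≢1 : 0 ≢ 1
      0≢1 ()

    neighbours : ∀ {a b c : Fin m} (a≢b : a ≢ b) (a≢c : a ≢ c) → b ≢ c → Adj (twoOneV a≢b) (twoOneV a≢c)
    neighbours {a} {b} {c} a≢b a≢c b≢c = Adjᶠ⇒Adj {u = twoOneV a≢b} {v = twoOneV a≢c} (Differ₂⇒Adjᶠ (differ₂ b c b≢c
      (λ e → 1≢0 (trans (sym (twoOneV-b a≢b)) (trans e (twoOneV-off a≢c b (a≢b ∘ sym) b≢c))))
      (λ e → 1≢0 (trans (sym (twoOneV-b a≢c)) (trans (sym e) (twoOneV-off a≢b c (a≢c ∘ sym) (b≢c ∘ sym)))))
      (λ r r≢b r≢c → fin-cases r a (λ { refl → trans (twoOneV-a a≢b) (sym (twoOneV-a a≢c)) })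
         λ r≢a → trans (twoOneV-off a≢b r r≢a r≢b) (sym (twoOneV-off a≢c r r≢a r≢c)))))
      where
      1≢0 : 1 ≢ 0
      1≢0 ()

    image-of : ∀ {a b : Fin m} (a≢b : a ≢ b) → g (twoOneV a≢b) ≡ twoOneV a≢b ⊎ g (twoOneV a≢b) ≡ τ (twoOneV a≢b)
    image-of a≢b = fixes-or-swaps (twoOneV a≢b) (twoOneV-a a≢b)

    fixed-change : ∀ {a b c : Fin m} → a ≢ b → a ≢ c → b ≢ c → Fixed a b → Fixed a c
    fixed-change a≢b a≢c b≢c fixed a≢c′ = fromInj₁ (λ swapped → ⊥-elim (proj₁ (mixed-impossible a≢b a≢c′ b≢c)
          (subst₂ Adj (fixed a≢b) (trans swapped (τ-twoOneV a≢c′)) (adj (neighbours a≢b a≢c′ b≢c))))) (image-of a≢c′)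

    swapped-change : ∀ {a b c : Fin m} → a ≢ b → a ≢ c → b ≢ c → Swapped a b → Swapped a c
    swapped-change a≢b a≢c b≢c swapped a≢c′ = fromInj₂ (λ fixed → ⊥-elim (proj₂ (mixed-impossible a≢b a≢c′ b≢c)
          (subst₂ Adj (trans (swapped a≢b) (τ-twoOneV a≢b)) fixed (adj (neighbours a≢b a≢c′ b≢c))))) (image-of a≢c′)

    -- 2e_b + e_a = τ (2e_a + e_b); a mixed choice would make g identify them.
    fixed-swap : ∀ {a b : Fin m} → a ≢ b → Fixed a b → Fixed b a
    fixed-swap {a} {b} a≢b fixed b≢a = fromInj₁ (λ swapped → ⊥-elim (distinct (injective (trans swapped (trans (τ-twoOneV b≢a)
            (trans (twoOneV-irrelevant (b≢a ∘ sym) a≢b) (sym (fixed a≢b)))))))) (image-of b≢a)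
      where
      distinct : twoOneV b≢a ≢ twoOneV a≢b
      distinct e = 1≢2 (trans (sym (twoOneV-b b≢a)) (trans (cong (λ v → ⟦ v ⟧ _) e) (twoOneV-a a≢b)))
        where
        1≢2 : 1 ≢ 2
        1≢2 ()

    swapped-swap : ∀ {a b : Fin m} → a ≢ b → Swapped a b → Swapped b a
    swapped-swap {a} {b} a≢b swapped b≢a = fromInj₂ (λ fixed → ⊥-elim (distinct (injective (trans fixed (sym (trans (swapped a≢b)
            (trans (τ-twoOneV a≢b) (twoOneV-irrelevant (a≢b ∘ sym) b≢a)))))))) (image-of b≢a)
      where
      distinct : twoOneV b≢a ≢ twoOneV a≢b
      distinct e = 1≢2 (trans (sym (twoOneV-b b≢a)) (trans (cong (λ v → ⟦ v ⟧ _) e) (twoOneV-a a≢b)))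
        where
        1≢2 : 1 ≢ 2
        1≢2 ()

  classification : ∀ {a₀ a₁ : Fin m} → a₀ ≢ a₁ → (∀ v → g v ≡ v) ⊎ (∀ v → g v ≡ τ v)
  classification {a₀} {a₁} a₀≢a₁ = by-image (image-of a₀≢a₁)
    where
    by-image : g (twoOneV a₀≢a₁) ≡ twoOneV a₀≢a₁ ⊎ g (twoOneV a₀≢a₁) ≡ τ (twoOneV a₀≢a₁) → (∀ v → g v ≡ v) ⊎ (∀ v → g v ≡ τ v)
    by-image (inj₁ fixed) = inj₁ (every-vertex (λ v → g v ≡ v)
      (λ i≢j → pairs-connected Fixed fixed-change fixed-swap a₀≢a₁
                 (λ a₀≢a₁′ → subst (λ w → g w ≡ w) (twoOneV-irrelevant a₀≢a₁ a₀≢a₁′) fixed) i≢j i≢j)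
      fixes-no-two)
    by-image (inj₂ swapped) = inj₂ (every-vertex (λ v → g v ≡ τ v)
      (λ i≢j → pairs-connected Swapped swapped-change swapped-swap a₀≢a₁
                 (λ a₀≢a₁′ → subst (λ w → g w ≡ τ w) (twoOneV-irrelevant a₀≢a₁ a₀≢a₁′) swapped) i≢j i≢j)
      (λ v ¬two → trans (fixes-no-two v ¬two) (sym (vertex-ext (τ-no-two v ¬two)))))

-- The layer of SR(m, n + 1) with coordinate i positive is a copy of SR(m, n):
-- raise adds eᵢ, lower subtracts it.
module Layer {m n : ℕ} (i : Fin m) where
  private
    raiseᶠ : (Fin m → ℕ) → Fin m → ℕ
    raiseᶠ h = h [ i ]≔ suc (h i)

    lowerᶠ : (Fin m → ℕ) → Fin m → ℕ
    lowerᶠ h = h [ i ]≔ pred (h i)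

  abstract
    ∑raise : (w : Vertex m n) → ∑ (raiseᶠ ⟦ w ⟧) ≡ suc n
    ∑raise w = +-cancelʳ-≡ (⟦ w ⟧ i) _ _
      (trans (∑-update ⟦ w ⟧ i (suc (⟦ w ⟧ i))) (trans (cong (_+ suc (⟦ w ⟧ i)) ∑⟦ w ⟧) (+-suc n (⟦ w ⟧ i))))

    ∑lower : (v : Vertex m (suc n)) → ⟦ v ⟧ i ≢ 0 → ∑ (lowerᶠ ⟦ v ⟧) ≡ n
    ∑lower v vᵢ≢0 = +-cancelʳ-≡ (⟦ v ⟧ i) _ _
      (trans (∑-update ⟦ v ⟧ i (pred (⟦ v ⟧ i))) (trans (cong (_+ pred (⟦ v ⟧ i)) ∑⟦ v ⟧) (shift (⟦ v ⟧ i) vᵢ≢0)))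
      where
      shift : ∀ x → x ≢ 0 → suc n + pred x ≡ n + x
      shift zero x≢0 = ⊥-elim (x≢0 refl)
      shift (suc x) _ = sym (+-suc n x)

  raise : Vertex m n → Vertex m (suc n)
  raise w = mkV (raiseᶠ ⟦ w ⟧) (∑raise w)

  lower : (v : Vertex m (suc n)) → ⟦ v ⟧ i ≢ 0 → Vertex m n
  lower v vᵢ≢0 = mkV (lowerᶠ ⟦ v ⟧) (∑lower v vᵢ≢0)

  raise-i : ∀ w → ⟦ raise w ⟧ i ≡ suc (⟦ w ⟧ i)
  raise-i w = trans (mkV-at (raiseᶠ ⟦ w ⟧) (∑raise w) i) (≔-same ⟦ w ⟧ i _)

  raise-other : ∀ w {r} → r ≢ i → ⟦ raise w ⟧ r ≡ ⟦ w ⟧ r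
  raise-other w r≢i = trans (mkV-at (raiseᶠ ⟦ w ⟧) (∑raise w) _) (≔-other ⟦ w ⟧ _ r≢i)

  lower-i : ∀ v vᵢ≢0 → ⟦ lower v vᵢ≢0 ⟧ i ≡ pred (⟦ v ⟧ i)
  lower-i v vᵢ≢0 = trans (mkV-at (lowerᶠ ⟦ v ⟧) (∑lower v vᵢ≢0) i) (≔-same ⟦ v ⟧ i _)

  lower-other : ∀ v vᵢ≢0 {r} → r ≢ i → ⟦ lower v vᵢ≢0 ⟧ r ≡ ⟦ v ⟧ r
  lower-other v vᵢ≢0 r≢i = trans (mkV-at (lowerᶠ ⟦ v ⟧) (∑lower v vᵢ≢0) _) (≔-other ⟦ v ⟧ _ r≢i)

  raise-nonzero : ∀ w → ⟦ raise w ⟧ i ≢ 0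
  raise-nonzero w e with trans (sym (raise-i w)) e
  ... | ()

  raise-lower : ∀ v vᵢ≢0 → raise (lower v vᵢ≢0) ≡ v
  raise-lower v vᵢ≢0 = vertex-ext λ r → fin-cases r i
    (λ { refl → trans (raise-i (lower v vᵢ≢0)) (trans (cong suc (lower-i v vᵢ≢0)) (suc-pred (⟦ v ⟧ r) {{≢-nonZero vᵢ≢0}})) })
    (λ r≢i → trans (raise-other (lower v vᵢ≢0) r≢i) (lower-other v vᵢ≢0 r≢i))

  raise-injective : ∀ {w w′} → raise w ≡ raise w′ → w ≡ w′
  raise-injective {w} {w′} e = vertex-ext λ r → fin-cases r i
    (λ { refl → suc-injective (trans (sym (raise-i w)) (trans (cong (λ v → ⟦ v ⟧ r) e) (raise-i w′))) })
    (λ r≢i → trans (sym (raise-other w r≢i)) (trans (cong (λ v → ⟦ v ⟧ r) e) (raise-other w′ r≢i)))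

  private
    ∑Δ-raise : ∀ w w′ → ∑ (Δ ⟦ raise w ⟧ ⟦ raise w′ ⟧) ≡ ∑ (Δ ⟦ w ⟧ ⟦ w′ ⟧)
    ∑Δ-raise w w′ = ∑-cong λ r → fin-cases r i
      (λ { refl → cong₂ δ (raise-i w) (raise-i w′) })
      (λ r≢i → cong₂ δ (raise-other w r≢i) (raise-other w′ r≢i))

  raise-adj : ∀ w w′ → Adj w w′ → Adj (raise w) (raise w′)
  raise-adj w w′ a = Adjᶠ⇒Adj {u = raise w} {v = raise w′} (trans (∑Δ-raise w w′) (Adj⇒Adjᶠ {u = w} {v = w′} a))

  raise-adj⁻ : ∀ w w′ → Adj (raise w) (raise w′) → Adj w w′
  raise-adj⁻ w w′ a = Adjᶠ⇒Adj {u = w} {v = w′} (trans (sym (∑Δ-raise w w′)) (Adj⇒Adjᶠ {u = raise w} {v = raise w′} a))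

module Restriction {m n : ℕ} {g : Vertex m (suc n) → Vertex m (suc n)} (G : IsAut g)
                   (fixes : ∀ i → g (corner i) ≡ corner {m} {suc n} i) (i : Fin m) where
  open Layer {m} {n} i
  open Automorphism G
  open CornerFixing (λ ()) G fixes

  restrict : Vertex m n → Vertex m n
  restrict w = lower (g (raise w)) (support-image (raise w) (raise-nonzero w))

  raise-restrict : ∀ w → raise (restrict w) ≡ g (raise w)
  raise-restrict w = raise-lower (g (raise w)) (support-image (raise w) (raise-nonzero w))

  private
    inverse-keeps : ∀ v → ⟦ v ⟧ i ≢ 0 → ⟦ f⁻¹ v ⟧ i ≢ 0
    inverse-keeps v vᵢ≢0 e = vᵢ≢0 (trans (cong (λ w → ⟦ w ⟧ i) (sym (f∘f⁻¹ v))) (zero-image (f⁻¹ v) e))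

    extend : Vertex m n → Vertex m n
    extend w = lower (f⁻¹ (raise w)) (inverse-keeps (raise w) (raise-nonzero w))

    raise-extend : ∀ w → raise (extend w) ≡ f⁻¹ (raise w)
    raise-extend w = raise-lower (f⁻¹ (raise w)) (inverse-keeps (raise w) (raise-nonzero w))

  restrict-aut : IsAut restrict
  restrict-aut = aut-from-inverse extend
    (λ w → raise-injective (trans (raise-extend (restrict w)) (trans (cong f⁻¹ (raise-restrict w)) (f⁻¹∘f (raise w)))))
    (λ w → raise-injective (trans (raise-restrict (extend w)) (trans (cong g (raise-extend w)) (f∘f⁻¹ (raise w)))))
    (λ w w′ a → raise-adj⁻ (restrict w) (restrict w′)
       (subst₂ Adj (sym (raise-restrict w)) (sym (raise-restrict w′)) (adj (raise-adj w w′ a))))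
    (λ w w′ a → raise-adj⁻ (extend w) (extend w′)
       (subst₂ Adj (sym (raise-extend w)) (sym (raise-extend w′)) (Automorphism.adj inverse (raise-adj w w′ a))))

  restrict-zero : ∀ w {p} → p ≢ i → ⟦ w ⟧ p ≡ 0 → ⟦ restrict w ⟧ p ≡ 0
  restrict-zero w p≢i wₚ≡0 = trans (lower-other (g (raise w)) (support-image (raise w) (raise-nonzero w)) p≢i) (zero-image (raise w) (trans (raise-other w p≢i) wₚ≡0))

  identity-on-layer : (∀ w → restrict w ≡ w) → ∀ v → ⟦ v ⟧ i ≢ 0 → g v ≡ v
  identity-on-layer restrict≡id v vᵢ≢0 = begin
    g v                       ≡⟨ cong g (raise-lower v vᵢ≢0) ⟨
    g (raise (lower v vᵢ≢0))   ≡⟨ raise-restrict (lower v vᵢ≢0) ⟨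
    raise (restrict (lower v vᵢ≢0)) ≡⟨ cong raise (restrict≡id (lower v vᵢ≢0)) ⟩
    raise (lower v vᵢ≢0)       ≡⟨ raise-lower v vᵢ≢0 ⟩
    v                         ∎
    where open ≡-Reasoning

  corner-permutation-trivial : n ≢ 0 → (σ : Permutation′ m) →
    (∀ j p → ⟦ restrict (corner j) ⟧ p ≡ ⟦ corner {m} {n} j ⟧ (σ ⟨$⟩ʳ p)) → ∀ p → σ ⟨$⟩ʳ p ≡ p
  corner-permutation-trivial n≢0 σ acts p = fin-cases p i (λ { refl → fixes-i }) (fixes-off-i p)
    where
    fixes-off-i : ∀ p → p ≢ i → σ ⟨$⟩ʳ p ≡ p
    fixes-off-i p p≢i = fin-cases p (σ ⟨$⟩ʳ p) sym λ p≢σp →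
      ⊥-elim (n≢0 (trans (sym (corner-at (σ ⟨$⟩ʳ p))) (trans (sym (acts (σ ⟨$⟩ʳ p) p))
                   (restrict-zero (corner (σ ⟨$⟩ʳ p)) p≢i (corner-off p≢σp)))))
    fixes-i : σ ⟨$⟩ʳ i ≡ i
    fixes-i = fin-cases (σ ⟨$⟩ʳ i) i (λ e → e) λ σi≢i →
      ⊥-elim (σi≢i (trans (sym (inverseˡ σ)) (trans (cong (σ ⟨$⟩ˡ_) (fixes-off-i (σ ⟨$⟩ʳ i) σi≢i)) (inverseˡ σ))))

Classified : ℕ → ℕ → Set
Classified m n = ∀ (f : Vertex m n → Vertex m n) → IsAut f →
  ∃ λ (σ : Permutation′ m) → Realizes f (permuteVec σ) ⊎ ((n ≡ 3) × Realizes f (permuteVec σ ∘ tauVec))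

tauVec-corner : ∀ {m n} → n ≢ 2 → (j : Fin m) → tauVec (proj₁ (corner {m} {n} j)) ≡ proj₁ (corner j)
tauVec-corner n≢2 j = tauVec-no-two _ λ p e → fin-cases p j
  (λ { refl → n≢2 (trans (sym (corner-at p)) e) }) (λ p≢j → 0≢2 (trans (sym (corner-off p≢j)) e))
  where
  0≢2 : 0 ≢ 2
  0≢2 ()

LayerBehaviour : ∀ {m n} → (Vertex m n → Vertex m n) → Set
LayerBehaviour {n = n} r = (∀ w → r w ≡ w) ⊎ ((n ≡ 3) × Realizes r tauVec)

-- By the induction hypothesis, the restriction to a layer is a coordinate permutation,
-- possibly after τ, and that permutation fixes each corner, so it is trivial.
layer-behaviour : ∀ {m n} → 2 < n → Classified m n → {g : Vertex m (suc n) → Vertex m (suc n)} (G : IsAut g)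
  (fixes : ∀ i → g (corner i) ≡ corner {m} {suc n} i) (i : Fin m) → LayerBehaviour (Restriction.restrict G fixes i)
layer-behaviour {m} {n} n>2 IH G fixes i = from-IH (IH restrict restrict-aut)
  where
  open Restriction G fixes i
  n≢0 : n ≢ 0
  n≢0 = m<n⇒n≢0 n>2
  n≢2 : n ≢ 2
  n≢2 refl = <-irrefl refl n>2
  at : ∀ {u v : Vec ℕ m} p → u ≡ v → lookup u p ≡ lookup v p
  at p = cong (λ u → lookup u p)
  from-IH : (∃ λ σ → Realizes restrict (permuteVec σ) ⊎ ((n ≡ 3) × Realizes restrict (permuteVec σ ∘ tauVec))) →
            LayerBehaviour restrict
  from-IH (σ , inj₁ realizes) = inj₁ λ w → vertex-ext λ p →
    trans (at p (realizes w)) (trans (lookup-permuteVec σ (proj₁ w) p) (cong ⟦ w ⟧ (trivial p)))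
    where
    trivial : ∀ p → σ ⟨$⟩ʳ p ≡ p
    trivial = corner-permutation-trivial n≢0 σ λ j p →
      trans (at p (realizes (corner j))) (lookup-permuteVec σ (proj₁ (corner {m} {n} j)) p)
  from-IH (σ , inj₂ (n≡3 , realizes)) = inj₂ (n≡3 , λ w → vec-ext λ p →
    trans (at p (realizes w)) (trans (lookup-permuteVec σ (tauVec (proj₁ w)) p) (cong (lookup (tauVec (proj₁ w))) (trivial p))))
    where
    trivial : ∀ p → σ ⟨$⟩ʳ p ≡ p
    trivial = corner-permutation-trivial n≢0 σ λ j p →
      trans (at p (realizes (corner j)))
            (trans (lookup-permuteVec σ (tauVec (proj₁ (corner {m} {n} j))) p) (at (σ ⟨$⟩ʳ p) (tauVec-corner n≢2 j)))

module _ {m} {i j k : Fin m} (i≢j : i ≢ j) (i≢k : i ≢ k) (j≢k : j ≢ k) where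
  private
    onesᶠ : Fin m → ℕ
    onesᶠ = (λ _ → 0) [ i ]≔ 1 [ j ]≔ 1 [ k ]≔ 1

    at-i : onesᶠ i ≡ 1
    at-i = trans (≔-other _ 1 i≢k) (trans (≔-other _ 1 i≢j) (≔-same _ i 1))

    at-j : onesᶠ j ≡ 1
    at-j = trans (≔-other _ 1 j≢k) (≔-same _ j 1)

    at-k : onesᶠ k ≡ 1
    at-k = ≔-same _ k 1

    off : ∀ r → r ≢ i → r ≢ j → r ≢ k → onesᶠ r ≡ 0
    off r r≢i r≢j r≢k = trans (≔-other _ 1 r≢k) (trans (≔-other _ 1 r≢j) (≔-other _ 1 r≢i))

  abstract
    ∑onesᶠ : ∑ onesᶠ ≡ 3
    ∑onesᶠ = trans (∑-three onesᶠ i≢j i≢k j≢k off) (cong₂ _+_ (cong₂ _+_ at-i at-j) at-k)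

  onesV : Vertex m 3
  onesV = mkV onesᶠ ∑onesᶠ

  onesV-i : ⟦ onesV ⟧ i ≡ 1
  onesV-i = trans (mkV-at onesᶠ ∑onesᶠ i) at-i

  onesV-j : ⟦ onesV ⟧ j ≡ 1
  onesV-j = trans (mkV-at onesᶠ ∑onesᶠ j) at-j

  onesV-no-two : ∀ r → ⟦ onesV ⟧ r ≢ 2
  onesV-no-two r e = fin-cases r i (λ { refl → 1≢2 (trans (sym at-i) e′) }) λ r≢i →
                     fin-cases r j (λ { refl → 1≢2 (trans (sym at-j) e′) }) λ r≢j →
                     fin-cases r k (λ { refl → 1≢2 (trans (sym at-k) e′) }) λ r≢k →
                     0≢2 (trans (sym (off r r≢i r≢j r≢k)) e′)
    where
    e′ : onesᶠ r ≡ 2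
    e′ = trans (sym (mkV-at onesᶠ ∑onesᶠ r)) e
    1≢2 : 1 ≢ 2
    1≢2 ()
    0≢2 : 0 ≢ 2
    0≢2 ()

-- On SR(m,4) no layer restriction of a corner-fixing automorphism is τ: the vertex
-- x = eᵢ + 2e_j + e_k lies in the layers of i and j; the j-layer forces g x = x,
-- while τ in the i-layer would move the coordinate 2 of x - eᵢ.
no-τ-layer : ∀ {m n} → n ≡ 3 → ThirdPosition m → {g : Vertex m (suc n) → Vertex m (suc n)} (G : IsAut g)
  (fixes : ∀ i → g (corner i) ≡ corner {m} {suc n} i) →
  (∀ i → LayerBehaviour (Restriction.restrict G fixes i)) → ∀ i → ¬ Realizes (Restriction.restrict G fixes i) tauVec
no-τ-layer {m} refl third {g} G fixes behaviour i τ-layer = 2≢1 (trans (sym wⱼ≡2) (trans (cong (λ u → ⟦ u ⟧ j) (sym w-fixed)) rᵢw-j≡1))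
  where
  j = proj₁ (third i i)
  i≢j : i ≢ j
  i≢j = proj₁ (proj₂ (third i i)) ∘ sym
  k = proj₁ (third i j)
  i≢k : i ≢ k
  i≢k = proj₁ (proj₂ (third i j)) ∘ sym
  j≢k : j ≢ k
  j≢k = proj₂ (proj₂ (third i j)) ∘ sym
  module Rᵢ = Restriction G fixes i
  module Rⱼ = Restriction G fixes j
  module Lᵢ = Layer {m} {3} i
  module Lⱼ = Layer {m} {3} j
  2≢1 : 2 ≢ 1
  2≢1 ()
  w′ = onesV i≢j i≢k j≢k
  x = Lⱼ.raise w′
  -- the j-layer restriction fixes w′, hence g x = x
  x-fixed : g x ≡ x
  x-fixed = trans (sym (Rⱼ.raise-restrict w′)) (cong Lⱼ.raise (fixes-w′ (behaviour j)))
    where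
    fixes-w′ : LayerBehaviour Rⱼ.restrict → Rⱼ.restrict w′ ≡ w′
    fixes-w′ (inj₁ identity) = identity w′
    fixes-w′ (inj₂ (_ , τ-realized)) = vertex-ext λ r → trans (cong (λ u → lookup u r) (τ-realized w′))
                                    (cong (λ u → lookup u r) (tauVec-no-two (proj₁ w′) (onesV-no-two i≢j i≢k j≢k)))
  -- so w = x - eᵢ = 2e_j + e_k is fixed by the i-layer restriction
  xᵢ≢0 : ⟦ x ⟧ i ≢ 0
  xᵢ≢0 e with trans (sym (trans (Lⱼ.raise-other w′ i≢j) (onesV-i i≢j i≢k j≢k))) e
  ... | ()
  w = Lᵢ.lower x xᵢ≢0
  w-fixed : Rᵢ.restrict w ≡ w
  w-fixed = Lᵢ.raise-injective (trans (Rᵢ.raise-restrict w) (trans (cong g (Lᵢ.raise-lower x xᵢ≢0)) (trans x-fixed (sym (Lᵢ.raise-lower x xᵢ≢0)))))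
  wⱼ≡2 : ⟦ w ⟧ j ≡ 2
  wⱼ≡2 = trans (Lᵢ.lower-other x xᵢ≢0 (i≢j ∘ sym)) (trans (Lⱼ.raise-i w′) (cong suc (onesV-j i≢j i≢k j≢k)))
  -- but τ turns that coordinate 2 into 1
  rᵢw-j≡1 : ⟦ Rᵢ.restrict w ⟧ j ≡ 1
  rᵢw-j≡1 = trans (cong (λ u → lookup u j) (τ-layer w))
     (trans (cong (λ u → lookup u j) (tauVec-two (proj₁ w) wⱼ≡2)) (trans (lookup-map j swap12 (proj₁ w)) (cong swap12 wⱼ≡2)))

-- For n ≥ 3, by the induction hypothesis for SR(m,n), every corner-fixing
-- automorphism of SR(m, n + 1) is the identity: each vertex lies in some layer,
-- and every layer restriction is the identity.
corner-fixing-identity : ∀ {m n} → 2 < n → ThirdPosition m → Classified m n →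
  {g : Vertex m (suc n) → Vertex m (suc n)} (G : IsAut g) (fixes : ∀ i → g (corner i) ≡ corner {m} {suc n} i) → ∀ v → g v ≡ v
corner-fixing-identity {m} {n} n>2 third IH {g} G fixes v = in-layer (∑-nonzero ⟦ v ⟧ (λ e → 1+n≢0 (trans (sym ∑⟦ v ⟧) e)))
  where
  behaviour : ∀ i → LayerBehaviour (Restriction.restrict G fixes i)
  behaviour = layer-behaviour n>2 IH G fixes
  in-layer : (∃ λ i → ⟦ v ⟧ i ≢ 0) → g v ≡ v
  in-layer (i , vᵢ≢0) = by-behaviour (behaviour i)
    where
    by-behaviour : LayerBehaviour (Restriction.restrict G fixes i) → g v ≡ v
    by-behaviour (inj₁ identity) = Restriction.identity-on-layer G fixes i identity v vᵢ≢0
    by-behaviour (inj₂ (n≡3 , τ-realized)) = ⊥-elim (no-τ-layer n≡3 third G fixes behaviour i τ-realized)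

private
  realize : ∀ {m n} {f g : Vertex m n → Vertex m n} {h : Vec ℕ m → Vec ℕ m} (σ : Permutation′ m) →
            (∀ v → f v ≡ permuteV σ (g v)) → Realizes g h → Realizes f (permuteVec σ ∘ h)
  realize σ f≡σ∘g g-realizes v = trans (cong proj₁ (f≡σ∘g v)) (cong (permuteVec σ) (g-realizes v))

classified-3 : ∀ {m} → 2 < m → Classified m 3
classified-3 {suc m} m>2 f F = σ , by-classification (classification a₀≢a₁)
  where
  open Normalised (normalise (s≤s (s≤s (s≤s z≤n))) (third-position m>2) F)
  open CornerFixing3 g-aut g-fixes-corners
  a₀≢a₁ = proj₁ (proj₂ (third-position m>2 zero zero))
  by-classification : (∀ v → g v ≡ v) ⊎ (∀ v → g v ≡ τ v) →
                      Realizes f (permuteVec σ) ⊎ ((3 ≡ 3) × Realizes f (permuteVec σ ∘ tauVec))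
  by-classification (inj₁ g≡id) = inj₁ (realize {h = λ u → u} σ f≡σ∘g (λ v → cong proj₁ (g≡id v)))
  by-classification (inj₂ g≡τ) = inj₂ (refl , realize {h = tauVec} σ f≡σ∘g (λ v → cong proj₁ (g≡τ v)))

classified-step : ∀ {m n} → 2 < m → 2 < n → Classified m n → Classified m (suc n)
classified-step m>2 n>2 IH f F = σ , inj₁ (realize {h = λ u → u} σ f≡σ∘g (λ v → cong proj₁ (corner-fixing-identity n>2 (third-position m>2) IH g-aut g-fixes-corners v)))
  where open Normalised (normalise (<-trans n>2 (n<1+n _)) (third-position m>2) F)

classified : ∀ {m n} → 2 < m → 2 < n → Classified m n
classified {n = 1} _ (s≤s ())
classified {n = 2} _ (s≤s (s≤s ()))
classified {n = 3} m>2 _ = classified-3 m>2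
classified {n = suc (suc (suc (suc k)))} m>2 _ = classified-step m>2 3≤3+k (classified {n = suc (suc (suc k))} m>2 3≤3+k)
  where
  3≤3+k : 2 < 3 + k
  3≤3+k = s≤s (s≤s (s≤s z≤n))

-- Sym(m) acts faithfully: σ is recovered from where it sends the corners.
permutation-faithful : ∀ {m n} → n ≢ 0 → (σ ρ : Permutation′ m) → AgreeOnVertices n (permuteVec σ) (permuteVec ρ) → σ ≈ ρ
permutation-faithful {m} {n} n≢0 σ ρ agree p = corner-unique n≢0 c (corner-at (σ ⟨$⟩ʳ p)) (begin
  ⟦ c ⟧ (ρ ⟨$⟩ʳ p)                 ≡⟨ lookup-permuteVec ρ (proj₁ c) p ⟨
  lookup (permuteVec ρ (proj₁ c)) p ≡⟨ cong (λ u → lookup u p) (agree (proj₁ c) (proj₂ c)) ⟨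
  lookup (permuteVec σ (proj₁ c)) p ≡⟨ lookup-permuteVec σ (proj₁ c) p ⟩
  ⟦ c ⟧ (σ ⟨$⟩ʳ p)                 ≡⟨ corner-at (σ ⟨$⟩ʳ p) ⟩
  n                                ∎)
  where
  open ≡-Reasoning
  c : Vertex m n
  c = corner (σ ⟨$⟩ʳ p)

-- τ is not a coordinate permutation: it would have to send every b ≢ a to the
-- position a of the 2 in 2·e_a + e_b.
τ-not-permutation : ∀ {m} → 2 < m → ¬ ∃ λ (σ : Permutation′ m) → AgreeOnVertices 3 (permuteVec σ) tauVec
τ-not-permutation {suc m} m>2 (σ , agree) = b₁≢b₂ (trans (sym (inverseˡ σ)) (trans (cong (σ ⟨$⟩ˡ_) (trans (to-a b₁≢a) (sym (to-a b₂≢a)))) (inverseˡ σ)))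
  where
  a : Fin (suc m)
  a = zero
  b₁ = proj₁ (third-position m>2 a a)
  b₁≢a : b₁ ≢ a
  b₁≢a = proj₁ (proj₂ (third-position m>2 a a))
  b₂ = proj₁ (third-position m>2 a b₁)
  b₂≢a : b₂ ≢ a
  b₂≢a = proj₁ (proj₂ (third-position m>2 a b₁))
  b₁≢b₂ : b₁ ≢ b₂
  b₁≢b₂ = proj₂ (proj₂ (third-position m>2 a b₁)) ∘ sym
  to-a : ∀ {b} → b ≢ a → σ ⟨$⟩ʳ b ≡ a
  to-a {b} b≢a = fin-cases (σ ⟨$⟩ʳ b) a (λ e → e) λ σb≢a → ⊥-elim (fin-cases (σ ⟨$⟩ʳ b) b
    (λ e → 1≢2 (trans (sym (twoOneV-b a≢b)) (trans (cong ⟦ U ⟧ (sym e)) value)))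
    (λ σb≢b → 0≢2 (trans (sym (twoOneV-off a≢b (σ ⟨$⟩ʳ b) σb≢a σb≢b)) value)))
    where
    a≢b = b≢a ∘ sym
    U = twoOneV a≢b
    -- the coordinate of U at σ b is the coordinate of τ U at b, namely 2
    value : ⟦ U ⟧ (σ ⟨$⟩ʳ b) ≡ 2
    value = trans (sym (lookup-permuteVec σ (proj₁ U) b)) (trans (cong (λ u → lookup u b) (agree (proj₁ U) (proj₂ U)))
              (trans (cong (λ u → lookup u b) (τ-realizes U)) (trans (cong (λ v → ⟦ v ⟧ b) (τ-twoOneV a≢b)) (twoOneV-a b≢a))))
    1≢2 : 1 ≢ 2
    1≢2 ()
    0≢2 : 0 ≢ 2
    0≢2 ()

mainTheorem6 : (m n : ℕ) → 2 < m → 2 < n →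
    (∀ (σ ρ : Permutation′ m) → AgreeOnVertices n (permuteVec σ) (permuteVec ρ) → σ ≈ ρ)
    × (∀ (σ : Permutation′ m) → Σ (Vertex m n → Vertex m n) λ f → IsAut f × Realizes f (permuteVec σ))
    × (3 < n → ∀ (f : Vertex m n → Vertex m n) → IsAut f →
         ∃ λ (σ : Permutation′ m) → Realizes f (permuteVec σ))
    × (n ≡ 3 →
         (Σ (Vertex m n → Vertex m n) λ f → IsAut f × Realizes f tauVec)
         × (¬ ∃ λ (σ : Permutation′ m) → AgreeOnVertices n (permuteVec σ) tauVec)
         × (∀ (f : Vertex m n → Vertex m n) → IsAut f →
              ∃ λ (σ : Permutation′ m) →
                Realizes f (permuteVec σ) ⊎ Realizes f (permuteVec σ ∘ tauVec)))
mainTheorem6 m n m>2 n>2 =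
    permutation-faithful (m<n⇒n≢0 n>2)
  , (λ σ → permuteV σ , permuteV-aut σ , permuteV-realizes σ)
  , only-permutations
  , λ { refl → (τ , τ-aut , τ-realizes) , τ-not-permutation m>2 , permutations-and-τ }
  where
  only-permutations : 3 < n → ∀ f → IsAut f → ∃ λ σ → Realizes f (permuteVec σ)
  only-permutations 3<n f F with classified m>2 n>2 f F
  ... | σ , inj₁ realizes = σ , realizes
  ... | σ , inj₂ (refl , _) = ⊥-elim (<-irrefl refl 3<n)
  permutations-and-τ : ∀ f → IsAut f → ∃ λ σ → Realizes f (permuteVec σ) ⊎ Realizes f (permuteVec σ ∘ tauVec)
  permutations-and-τ f F with classified m>2 n>2 f F
  ... | σ , inj₁ realizes = σ , inj₁ realizes
  ... | σ , inj₂ (_ , realizes) = σ , inj₂ realizes
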